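{- For all $m\ge1$, the sequences $A^{(m)}$ and $B^{(m)}$ coincide.
   Context: Strings may be finite or infinite. For a nonempty finite string $U$ of positive integers, $\mathcal{C}(U)$ is the largest integer $k\ge1$ with $U=XY^k$ for strings $X,Y$, $Y$ nonempty; $\mathcal{C}^{(m)}(U)=\max\{m,\mathcal{C}(U)\}$. For $m\ge1$ the sequence $A^{(m)}=a^{(m)}(1),a^{(m)}(2),\ldots$ is given by $a^{(m)}(1)=m$, $a^{(m)}(i+1)=\mathcal{C}^{(m)}(a^{(m)}(1),\ldots,a^{(m)}(i))$. Fix $m$. Blocks and glue: $B_1^{(m)}=m$; for $n\ge1$, if $B_n^{(m)}$ is infinite then $B_{n+1}^{(m)}=B_n^{(m)}$ and $S_i^{(m)}=\emptyset$ for $i\ge n$; if $B_n^{(m)}$ is finite, let $s(1)=\mathcal{C}^{(m)}((B_n^{(m)})^{m+1})$, $s(i+1)=\mathcal{C}^{(m)}((B_n^{(m)})^{m+1}s(1)\ldots s(i))$; if some $i\ge1$ has $s(i+1)<m+1$, with $i$ least, $S_n^{(m)}=s(1),\ldots,s(i)$, otherwise $S_n^{(m)}=s(1),s(2),\ldots$ (infinite); and $B_{n+1}^{(m)}=(B_n^{(m)})^{m+1}S_n^{(m)}$. Since each $B_n^{(m)}$ is a prefix of $B_{n+1}^{(m)}$, the limit $B^{(m)}=\lim_{n\to\infty}B_n^{(m)}$ is well defined. -}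

module Defs where

open import Data.Nat using (ℕ; zero; suc; _≤_; _<ᵇ_; _⊔_; _∸_; _≡ᵇ_)
open import Data.List using (List; []; _∷_; _++_; concat; replicate; map; upTo; head; drop; length)
open import Data.Maybe using (Maybe; just; nothing; _<∣>_)
open import Data.Bool using (Bool; true; false; _∧_; if_then_else_)
open import Data.Product using (_×_; ∃-syntax)
open import Relation.Binary.PropositionalEquality using (_≡_; _≢_)

_^^_ : List ℕ → ℕ → List ℕ
Y ^^ k = concat (replicate k Y)

IsCurling : List ℕ → ℕ → Set
IsCurling U k =
  1 ≤ k
  × (∃[ X ] ∃[ Y ] (Y ≢ [] × U ≡ X ++ (Y ^^ k)))
  × (∀ k' X Y → Y ≢ [] → U ≡ X ++ (Y ^^ k') → k' ≤ k)

allᵇ : (ℕ → Bool) → List ℕ → Bool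
allᵇ p []       = true
allᵇ p (x ∷ xs) = p x ∧ allᵇ p xs

-- A possibly infinite string, as a (prefix-closed) partial sequence:
-- position j (0-based) holds 'just x' if the string has an entry x there,
-- 'nothing' if the string is shorter than j+1.
PString : Set
PString = ℕ → Maybe ℕ

firstGap : List (Maybe ℕ) → Maybe (List ℕ)
firstGap []             = nothing
firstGap (nothing ∷ _)  = just []
firstGap (just x ∷ xs)  = Data.Maybe.map (x ∷_) (firstGap xs)

-- Everything below is parameterised by a function C : List ℕ → ℕ which, in
-- the theorem, is assumed to satisfy IsCurling U (C U) for every nonempty U,
-- and by m.
module _ (C : List ℕ → ℕ) (m : ℕ) where

  Cm : List ℕ → ℕ
  Cm U = m ⊔ C U

  -- Apref n = a(1), ..., a(n+1)   (first n+1 terms of A^(m))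
  Apref : ℕ → List ℕ
  Apref zero    = m ∷ []
  Apref (suc n) = Apref n ++ (Cm (Apref n) ∷ [])

  -- Aseq i = a^(m)(i+1)   (0-based indexing)
  Aseq : ℕ → ℕ
  Aseq zero    = m
  Aseq (suc i) = Cm (Apref i)

  module Glue (b : List ℕ) where
    base : List ℕ
    base = b ^^ suc m

    -- spref k = s(1), ..., s(k)
    spref : ℕ → List ℕ
    spref zero    = []
    spref (suc k) = spref k ++ (Cm (base ++ spref k) ∷ [])

    -- g k = s(k+1)
    g : ℕ → ℕ
    g k = Cm (base ++ spref k)

    -- S = s(1..i) with i least ≥ 1 such that s(i+1) < m+1 (S infinite if no
    -- such i).  Hence s(k+1) belongs to S iff no i' with 1 ≤ i' ≤ k has
    -- s(i'+1) < m+1, i.e. iff m < s(t+1) for all t ∈ {1,…,k}.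
    inGlue : ℕ → Bool
    inGlue k = allᵇ (λ t → m <ᵇ g t) (map suc (upTo k))

    -- the (possibly infinite) string b^(m+1) S
    next : PString
    next j = head (drop j base) <∣>
             (if inGlue (j ∸ length base) then just (g (j ∸ length base)) else nothing)

  -- Blk n = B_{n+1}^(m), as a possibly infinite string.  For B_{n+2} at position j: if B_{n+1} has entries at all
  -- positions 0..j, then (whether B_{n+1} is infinite, so B_{n+2} = B_{n+1},
  -- or finite, in which case it is a prefix of B_{n+2}) the entry is that of
  -- B_{n+1}; otherwise B_{n+1} is the finite list b read off before its first
  -- gap, and B_{n+2} = b^(m+1) S.
  Blk : ℕ → PString
  Blk zero j = if j ≡ᵇ 0 then just m else nothing
  Blk (suc n) j with firstGap (map (Blk n) (upTo (suc j)))
  ... | nothing = Blk n j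
  ... | just b  = Glue.next b j

-- Write b = m + 1, ν for the b-adic valuation and ℓ u for the length of the glue S_{u+1}.
-- Then A^(m) is the concatenation, over i = 0, 1, 2, …, of the units  m^b S_1 S_2 ⋯ S_{ν(i+1)+1},
-- and B_{n+2}^(m) consists of the first b^n units.  Inside a glue copy, the prefix of length x ends with a copy of the
-- prefix leading to the same place in the first occurrence of that glue, and copying a suffix
-- does not change a curling number that exceeds m.  Inside a run of m's, a curling number above m
-- would give a suffix Y^b; it forces the lengths of m·d consecutive units, hence ν on m·d
-- consecutive integers, to repeat with shift d, which the b-adic valuation never does.  With the
-- layout in hand, induction on n shows that every entry of B_n^(m) is the corresponding entry of
-- A^(m), and that the glue S_n ends at the next position where A^(m) takes the value m.

module Submission where

open import Defs
open import Data.Nat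
open import Data.Nat.Properties
open import Data.Nat.Divisibility
open import Data.Nat.Induction using (<-rec)
open import Data.Nat.Tactic.RingSolver
open import Data.List using (List; []; _∷_; _++_; length; applyUpTo; map; upTo; head; drop)
open import Data.List.Properties using (map-upTo; length-applyUpTo; applyUpTo-∷ʳ; length-++; ++-identityʳ)
open import Data.Maybe using (Maybe; just; nothing; _<∣>_)
open import Data.Maybe.Properties using (just-injective)
open import Data.Bool using (Bool; true; false; _∧_; if_then_else_; T)
open import Data.Bool.Properties using (∧-zeroʳ)
open import Data.Product hiding (map)
open import Data.Sum using (_⊎_; inj₁; inj₂)
open import Data.Empty
open import Data.Unit using (tt)
open import Function using (_∘_)
open import Relation.Nullary
open import Relation.Nullary.Decidable using (_×-dec_)
open import Relation.Binary.PropositionalEquality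
open import Relation.Binary.Definitions using (tri<; tri≈; tri>)
open import Algebra.Properties.CommutativeSemigroup +-commutativeSemigroup using (xy∙z≈xz∙y)

nth : List ℕ → ℕ → ℕ
nth [] _ = 0
nth (x ∷ xs) zero = x
nth (x ∷ xs) (suc i) = nth xs i

nth-applyUpTo : ∀ (f : ℕ → ℕ) n i → i < n → nth (applyUpTo f n) i ≡ f i
nth-applyUpTo f (suc n) zero _ = refl
nth-applyUpTo f (suc n) (suc i) (s≤s lt) = nth-applyUpTo (f ∘ suc) n i lt

nth-++ˡ : ∀ xs ys i → i < length xs → nth (xs ++ ys) i ≡ nth xs i
nth-++ˡ (x ∷ xs) ys zero _ = refl
nth-++ˡ (x ∷ xs) ys (suc i) (s≤s lt) = nth-++ˡ xs ys i lt

nth-++ʳ : ∀ xs ys i → nth (xs ++ ys) (length xs + i) ≡ nth ys i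
nth-++ʳ [] ys i = refl
nth-++ʳ (x ∷ xs) ys i = nth-++ʳ xs ys i

length-^^ : ∀ (Y : List ℕ) k → length (Y ^^ k) ≡ k * length Y
length-^^ Y zero = refl
length-^^ Y (suc k) = trans (length-++ Y) (cong (length Y +_) (length-^^ Y k))

nth-^^-period : ∀ (Y : List ℕ) k i → i + length Y < k * length Y → nth (Y ^^ k) (i + length Y) ≡ nth (Y ^^ k) i
nth-^^-period Y zero i ()
nth-^^-period Y (suc k) i lt with i <? length Y
... | yes i<Y = begin
    nth (Y ++ Y ^^ k) (i + length Y) ≡⟨ cong (nth (Y ++ Y ^^ k)) (+-comm i (length Y)) ⟩
    nth (Y ++ Y ^^ k) (length Y + i) ≡⟨ nth-++ʳ Y (Y ^^ k) i ⟩
    nth (Y ^^ k) i ≡⟨ lemk k lt ⟩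
    nth Y i ≡⟨ sym (nth-++ˡ Y (Y ^^ k) i i<Y) ⟩
    nth (Y ++ Y ^^ k) i ∎
  where
  open ≡-Reasoning
  lemk : ∀ k → i + length Y < suc k * length Y → nth (Y ^^ k) i ≡ nth Y i
  lemk zero lt' = ⊥-elim (m+n≮n i (length Y) (subst (i + length Y <_) (+-identityʳ (length Y)) lt'))
  lemk (suc k) lt' = nth-++ˡ Y (Y ^^ k) i i<Y
... | no i≮Y = begin
    nth (Y ++ Y ^^ k) (i + length Y) ≡⟨ cong (nth (Y ++ Y ^^ k)) eq1 ⟩
    nth (Y ++ Y ^^ k) (length Y + (j + length Y)) ≡⟨ nth-++ʳ Y (Y ^^ k) (j + length Y) ⟩
    nth (Y ^^ k) (j + length Y) ≡⟨ nth-^^-period Y k j lt2 ⟩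
    nth (Y ^^ k) j ≡⟨ sym (nth-++ʳ Y (Y ^^ k) j) ⟩
    nth (Y ++ Y ^^ k) (length Y + j) ≡⟨ cong (nth (Y ++ Y ^^ k)) (sym eq2) ⟩
    nth (Y ++ Y ^^ k) i ∎
  where
  open ≡-Reasoning
  j : ℕ
  j = i ∸ length Y
  eq2 : i ≡ length Y + j
  eq2 = sym (trans (+-comm (length Y) j) (m∸n+n≡m (≮⇒≥ i≮Y)))
  eq1 : i + length Y ≡ length Y + (j + length Y)
  eq1 = trans (cong (_+ length Y) eq2) (+-assoc (length Y) j (length Y))
  lt2 : j + length Y < k * length Y
  lt2 = +-cancelˡ-< (length Y) (j + length Y) (k * length Y)
          (subst (_< length Y + k * length Y) eq1 lt)

nothing≢just : ∀ {y : ℕ} → nothing ≢ just y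
nothing≢just ()

just≢nothing : ∀ {y : ℕ} → just y ≢ nothing
just≢nothing ()

≢[]⇒length≥1 : ∀ (Y : List ℕ) → Y ≢ [] → 1 ≤ length Y
≢[]⇒length≥1 [] ne = ⊥-elim (ne refl)
≢[]⇒length≥1 (_ ∷ _) ne = s≤s z≤n

≤⇒≡+ : ∀ {T y} → T ≤ y → Σ ℕ λ z → y ≡ T + z
≤⇒≡+ {zero} {y} _ = y , refl
≤⇒≡+ {suc T} (s≤s le) = let (z , eq) = ≤⇒≡+ le in z , cong suc eq

x+yz+z≡x+[z+yz] : ∀ x y z → x + y * z + z ≡ x + (z + y * z)
x+yz+z≡x+[z+yz] = solve-∀

x+[y+zy]≡x+y+zy : ∀ x y z → x + (y + z * y) ≡ x + y + z * y
x+[y+zy]≡x+y+zy = solve-∀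

x+[y+zy]≡x+zy+y : ∀ x y z → x + (y + z * y) ≡ x + z * y + y
x+[y+zy]≡x+zy+y = solve-∀

x+yz+wz≡x+[w+y]z : ∀ x y z w → x + y * z + w * z ≡ x + (w + y) * z
x+yz+wz≡x+[w+y]z = solve-∀

x+y+2z≡x+[y+z]+z : ∀ x y z → x + y + 2 * z ≡ x + (y + z) + z
x+y+2z≡x+[y+z]+z = solve-∀

x+[y+[z+w]]≡x+y+z+w : ∀ x y z w → x + (y + (z + w)) ≡ x + y + z + w
x+[y+[z+w]]≡x+y+z+w = solve-∀

x+y+z+w≡x+z+w+y : ∀ x y z w → x + y + z + w ≡ x + z + w + y
x+y+z+w≡x+z+w+y = solve-∀

x+y+z+w≡x+[y+w+z] : ∀ x y z w → x + y + z + w ≡ x + (y + w + z)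
x+y+z+w≡x+[y+w+z] = solve-∀

x+[y+z+w+v]≡x+y+z+w+v : ∀ x y z w v → x + (y + z + w + v) ≡ x + y + z + w + v
x+[y+z+w+v]≡x+y+z+w+v = solve-∀

suc[x+y]+z≡suc[x+z+y] : ∀ x y z → suc (x + y) + z ≡ suc (x + z + y)
suc[x+y]+z≡suc[x+z+y] = solve-∀

x+y+suc[z+w]≡suc[x+[z+w]]+y : ∀ x y z w → x + y + suc (z + w) ≡ suc (x + (z + w)) + y
x+y+suc[z+w]≡suc[x+[z+w]]+y = solve-∀

x+suc[y]+z+w≡x+[suc[z]+w]+y : ∀ x y z w → x + suc y + z + w ≡ x + (suc z + w) + y
x+suc[y]+z+w≡x+[suc[z]+w]+y = solve-∀

applyUpTo-+ : ∀ (f : ℕ → ℕ) n n' → applyUpTo f (n + n') ≡ applyUpTo f n ++ applyUpTo (λ i → f (n + i)) n'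
applyUpTo-+ f zero n' = refl
applyUpTo-+ f (suc n) n' = cong (f 0 ∷_) (applyUpTo-+ (f ∘ suc) n n')

applyUpTo-cong : ∀ (f g : ℕ → ℕ) n → (∀ i → i < n → f i ≡ g i) → applyUpTo f n ≡ applyUpTo g n
applyUpTo-cong f g zero h = refl
applyUpTo-cong f g (suc n) h = cong₂ _∷_ (h 0 (s≤s z≤n)) (applyUpTo-cong (f ∘ suc) (g ∘ suc) n (λ i lt → h (suc i) (s≤s lt)))

firstGap-just : ∀ (F : ℕ → Maybe ℕ) (G : ℕ → ℕ) k g₀ → g₀ < k → (∀ i → i < g₀ → F i ≡ just (G i)) → F g₀ ≡ nothing → firstGap (applyUpTo F k) ≡ just (applyUpTo G g₀)
firstGap-just F G (suc k) zero _ _ eq rewrite eq = refl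
firstGap-just F G (suc k) (suc g₀) (s≤s lt) h eq rewrite h 0 (s≤s z≤n) =
  cong (Data.Maybe.map (G 0 ∷_)) (firstGap-just (F ∘ suc) (G ∘ suc) k g₀ lt (λ i l → h (suc i) (s≤s l)) eq)

firstGap-just⇒gap : ∀ (F : ℕ → Maybe ℕ) k L → firstGap (applyUpTo F k) ≡ just L → Σ ℕ λ i → i < k × F i ≡ nothing
firstGap-just⇒gap F (suc k) L eq with F 0 in e0
... | nothing = 0 , s≤s z≤n , e0
... | just y with firstGap (applyUpTo (F ∘ suc) k) in e1
... | just L' = let (i , lt , e) = firstGap-just⇒gap (F ∘ suc) k L' e1 in suc i , s≤s lt , e

firstGap-nothing⇒defined : ∀ (F : ℕ → Maybe ℕ) k → firstGap (applyUpTo F k) ≡ nothing → ∀ i → i < k → Σ ℕ λ x → F i ≡ just x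
firstGap-nothing⇒defined F (suc k) eq i lt with F 0 in e0
firstGap-nothing⇒defined F (suc k) () i lt | nothing
... | just y with firstGap (applyUpTo (F ∘ suc) k) in e1
firstGap-nothing⇒defined F (suc k) eq zero lt | just y | nothing = y , e0
firstGap-nothing⇒defined F (suc k) eq (suc i) (s≤s lt) | just y | nothing = firstGap-nothing⇒defined (F ∘ suc) k e1 i lt

head-drop-< : ∀ (f : ℕ → ℕ) n j → j < n → head (drop j (applyUpTo f n)) ≡ just (f j)
head-drop-< f (suc n) zero _ = refl
head-drop-< f (suc n) (suc j) (s≤s lt) = head-drop-< (f ∘ suc) n j lt

head-drop-≥ : ∀ (f : ℕ → ℕ) n j → n ≤ j → head (drop j (applyUpTo f n)) ≡ nothing
head-drop-≥ f zero zero _ = refl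
head-drop-≥ f zero (suc j) _ = refl
head-drop-≥ f (suc n) (suc j) (s≤s le) = head-drop-≥ (f ∘ suc) n j le

allᵇ-false⇒witness : ∀ (p : ℕ → Bool) (f : ℕ → ℕ) k → allᵇ p (applyUpTo f k) ≡ false → Σ ℕ λ t → t < k × p (f t) ≡ false
allᵇ-false⇒witness p f (suc k) eq with p (f 0) in e0
... | false = 0 , s≤s z≤n , e0
... | true = let (t , lt , e) = allᵇ-false⇒witness p (f ∘ suc) k eq in suc t , s≤s lt , e

allᵇ-true-intro : ∀ (p : ℕ → Bool) (f : ℕ → ℕ) k → (∀ t → t < k → p (f t) ≡ true) → allᵇ p (applyUpTo f k) ≡ true
allᵇ-true-intro p f zero h = refl
allᵇ-true-intro p f (suc k) h rewrite h 0 (s≤s z≤n) = allᵇ-true-intro p (f ∘ suc) k (λ t l → h (suc t) (s≤s l))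

allᵇ-false-intro : ∀ (p : ℕ → Bool) (f : ℕ → ℕ) k t → t < k → p (f t) ≡ false → allᵇ p (applyUpTo f k) ≡ false
allᵇ-false-intro p f (suc k) zero _ e rewrite e = refl
allᵇ-false-intro p f (suc k) (suc t) (s≤s lt) e = trans (cong (p (f 0) ∧_) (allᵇ-false-intro p (f ∘ suc) k t lt e)) (∧-zeroʳ (p (f 0)))

n<ᵇn≡false : ∀ n → (n <ᵇ n) ≡ false
n<ᵇn≡false n with n <ᵇ n in e
... | false = refl
... | true = ⊥-elim (<-irrefl refl (<ᵇ⇒< n n (subst T (sym e) tt)))

T⇒≡true : ∀ {x : Bool} → T x → x ≡ true
T⇒≡true {true} _ = refl

applyUpTo-periodic : ∀ (f : ℕ → ℕ) L c → (∀ c' z → c' < c → z < L → f (c' * L + z) ≡ f z) → applyUpTo f (c * L) ≡ applyUpTo f L ^^ c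
applyUpTo-periodic f L zero h = refl
applyUpTo-periodic f L (suc zero) h = trans (cong (applyUpTo f) (+-identityʳ L)) (sym (++-identityʳ _))
applyUpTo-periodic f L (suc (suc c)) h = trans (applyUpTo-+ f L (suc c * L))
  (cong (applyUpTo f L ++_) (trans (applyUpTo-periodic (λ i → f (L + i)) L (suc c) h')
     (cong (_^^ suc c) (applyUpTo-cong _ _ L (λ z zl → trans (cong f (cong (_+ z) (sym (+-identityʳ L)))) (h 1 z (s≤s (s≤s z≤n)) zl))))))
  where
    h' : ∀ c' z → c' < suc c → z < L → f (L + (c' * L + z)) ≡ f (L + z)
    h' c' z lt zl = trans (trans (cong f (sym (+-assoc L (c' * L) z))) (h (suc c') z (s≤s lt) zl))
                      (sym (trans (cong f (cong (_+ z) (sym (+-identityʳ L)))) (h 1 z (s≤s (s≤s z≤n)) zl)))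

quotRem : ∀ y L → 1 ≤ L → Σ ℕ λ c → Σ ℕ λ z → y ≡ c * L + z × z < L
quotRem zero L L≥1 = 0 , 0 , refl , L≥1
quotRem (suc y) L L≥1 with quotRem y L L≥1
... | (c , z , eq , zl) with suc z <? L
... | yes l = c , suc z , trans (cong suc eq) (sym (+-suc (c * L) z)) , l
... | no nl = suc c , 0 , trans (cong suc eq) (trans (sym (+-suc (c * L) z)) (trans (cong (c * L +_) (≤-antisym zl (≮⇒≥ nl))) (trans (+-comm (c * L) L) (sym (+-identityʳ _))))) , L≥1

module LeastWitness (Q : ℕ → Set) (dq : ∀ t → Dec (Q t)) where
  bounded? : ∀ K → Dec (Σ ℕ λ t → t ≤ K × Q t)
  bounded? zero with dq 0
  ... | yes q = yes (0 , z≤n , q)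
  ... | no nq = no λ { (zero , _ , q) → nq q }
  bounded? (suc K) with bounded? K | dq (suc K)
  ... | yes (t , le , q) | _ = yes (t , m≤n⇒m≤1+n le , q)
  ... | no _ | yes q = yes (suc K , ≤-refl , q)
  ... | no na | no nq = no λ { (t , le , q) → case≤ t le q }
    where
      case≤ : ∀ t → t ≤ suc K → Q t → ⊥
      case≤ t le q with t ≤? K
      ... | yes l = na (t , l , q)
      ... | no nl = nq (subst Q (≤-antisym le (≰⇒> nl)) q)

  least : ∀ K → (Σ ℕ λ t → t ≤ K × Q t) → Σ ℕ λ t → Q t × (∀ t' → t' < t → ¬ Q t')
  least zero (zero , _ , q) = 0 , q , λ t' ()
  least (suc K) (t , le , q) with bounded? K
  ... | yes ex = least K ex
  ... | no nex = t , q , λ t' lt q' → nex (t' , ≤-pred (≤-trans lt le) , q')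

∣⇒≤⁺ : ∀ {x y} → x ∣ y → 1 ≤ y → x ≤ y
∣⇒≤⁺ {x} {suc y} d _ = ∣⇒≤ d

module CurlingFacts (C : List ℕ → ℕ) (hC : ∀ U → U ≢ [] → IsCurling U (C U)) (m : ℕ) (m≥1 : 1 ≤ m) where
  a : ℕ → ℕ
  a = Aseq C m

  b : ℕ
  b = suc m

  pre : ℕ → List ℕ
  pre = applyUpTo a

  Apref≡pre : ∀ n → Apref C m n ≡ pre (suc n)
  Apref≡pre zero = refl
  Apref≡pre (suc n) = trans (cong (λ L → L ++ (Cm C m (Apref C m n) ∷ [])) (Apref≡pre n)) (applyUpTo-∷ʳ a (suc n))

  a≡m⊔C : ∀ k → 1 ≤ k → a k ≡ m ⊔ C (pre k)
  a≡m⊔C (suc k) _ = cong (λ L → m ⊔ C L) (Apref≡pre k)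

  length-pre : ∀ k → length (pre k) ≡ k
  length-pre k = length-applyUpTo a k

  pre≢[] : ∀ k → 1 ≤ k → pre k ≢ []
  pre≢[] (suc k) _ ()

  nth-pre : ∀ k y → y < k → nth (pre k) y ≡ a y
  nth-pre k y lt = nth-applyUpTo a k y lt

  Periodic : ℕ → ℕ → ℕ → Set
  Periodic s e p = ∀ y → s ≤ y → y + p < e → a y ≡ a (y + p)

  Periodic-restrict : ∀ {s e p s' e'} → Periodic s e p → s ≤ s' → e' ≤ e → Periodic s' e' p
  Periodic-restrict per le1 le2 y sy ye = per y (≤-trans le1 sy) (<-≤-trans ye le2)

  C-period : ∀ k → 1 ≤ k → Σ ℕ λ p → Σ ℕ λ s → 1 ≤ p × s + C (pre k) * p ≡ k × Periodic s k p
  C-period k k≥1 with hC (pre k) (pre≢[] k k≥1)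
  ... | (r≥1 , (X , Y , Y≢[] , eq) , mx) = length Y , length X , p≥1 , lenEq , per
    where
      c : ℕ
      c = C (pre k)
      p≥1 : 1 ≤ length Y
      p≥1 = ≢[]⇒length≥1 Y Y≢[]
      lenEq : length X + c * length Y ≡ k
      lenEq = trans (sym (trans (length-++ X) (cong (length X +_) (length-^^ Y c))))
                    (trans (cong length (sym eq)) (length-pre k))
      per : Periodic (length X) k (length Y)
      per y Xy yk = begin
          a y ≡⟨ sym (nth-pre k y (≤-trans (s≤s (m≤m+n y (length Y))) yk)) ⟩
          nth (pre k) y ≡⟨ cong (λ L → nth L y) eq ⟩
          nth (X ++ Y ^^ c) y ≡⟨ cong (nth (X ++ Y ^^ c)) yeq ⟩
          nth (X ++ Y ^^ c) (length X + i) ≡⟨ nth-++ʳ X (Y ^^ c) i ⟩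
          nth (Y ^^ c) i ≡⟨ sym (nth-^^-period Y c i lt) ⟩
          nth (Y ^^ c) (i + length Y) ≡⟨ sym (nth-++ʳ X (Y ^^ c) (i + length Y)) ⟩
          nth (X ++ Y ^^ c) (length X + (i + length Y)) ≡⟨ cong (nth (X ++ Y ^^ c)) (sym (trans (cong (_+ length Y) yeq) (+-assoc (length X) i (length Y)))) ⟩
          nth (X ++ Y ^^ c) (y + length Y) ≡⟨ cong (λ L → nth L (y + length Y)) (sym eq) ⟩
          nth (pre k) (y + length Y) ≡⟨ nth-pre k (y + length Y) yk ⟩
          a (y + length Y) ∎
        where
          open ≡-Reasoning
          i : ℕ
          i = y ∸ length X
          yeq : y ≡ length X + i
          yeq = sym (trans (+-comm (length X) i) (m∸n+n≡m Xy))
          lt : i + length Y < c * length Y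
          lt = +-cancelˡ-< (length X) (i + length Y) (c * length Y)
                 (subst₂ _<_ (trans (cong (_+ length Y) yeq) (+-assoc (length X) i (length Y))) (sym lenEq) yk)

  block : ℕ → ℕ → List ℕ
  block s n = applyUpTo (λ i → a (s + i)) n

  block-shift : ∀ r s p → Periodic s (s + suc (suc r) * p) p → block (s + p) p ≡ block s p
  block-shift r s p per = applyUpTo-cong _ _ p λ i i<p → trans (cong a (+-assoc s p i))
                (trans (cong (λ z → a (s + z)) (+-comm p i))
                (trans (cong a (sym (+-assoc s i p))) (sym (per (s + i) (m≤m+n s i)
                   (subst (_< s + suc (suc r) * p) (sym (+-assoc s i p))
                     (+-monoʳ-< s (<-≤-trans (+-monoˡ-< p i<p) (+-monoʳ-≤ p (m≤m+n p (r * p))))))))))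

  block-shift-^^ : ∀ r s p → Periodic s (s + suc r * p) p → block (s + p) p ^^ r ≡ block s p ^^ r
  block-shift-^^ zero s p per = refl
  block-shift-^^ (suc r) s p per = cong (_^^ suc r) (block-shift r s p per)

  pre-Periodic : ∀ r s p → Periodic s (s + r * p) p → applyUpTo (λ i → a (s + i)) (r * p) ≡ block s p ^^ r
  pre-Periodic zero s p per = refl
  pre-Periodic (suc r) s p per =
    trans (applyUpTo-+ (λ i → a (s + i)) p (r * p))
      (cong (block s p ++_)
        (trans (applyUpTo-cong _ _ _ (λ i _ → cong a (sym (+-assoc s p i))))
          (trans (pre-Periodic r (s + p) p (Periodic-restrict per (m≤m+n s p) (≤-reflexive (+-assoc s p (r * p)))))
            (block-shift-^^ r s p per))))

  periods≤C′ : ∀ s p r → 1 ≤ p → Periodic s (s + r * p) p → r ≤ C (pre (s + r * p))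
  periods≤C′ s p zero p≥1 per = z≤n
  periods≤C′ s zero (suc r) () per
  periods≤C′ s p@(suc _) (suc r) p≥1 per with hC (pre (s + suc r * p)) (pre≢[] _ k≥1)
    where
      k≥1 : 1 ≤ s + suc r * p
      k≥1 = ≤-trans p≥1 (≤-trans (m≤m+n p (r * p)) (m≤n+m _ s))
  ... | (_ , _ , mx) = mx (suc r) (pre s) (block s p) segne eq
    where
      segne : block s p ≢ []
      segne ()
      eq : pre (s + suc r * p) ≡ pre s ++ block s p ^^ suc r
      eq = trans (applyUpTo-+ a s (suc r * p)) (cong (pre s ++_) (pre-Periodic (suc r) s p per))

  periods≤C : ∀ k s p r → 1 ≤ p → s + r * p ≡ k → Periodic s k p → r ≤ C (pre k)
  periods≤C k s p r p≥1 eq per = subst (λ k → r ≤ C (pre k)) eq (periods≤C′ s p r p≥1 (subst (λ e → Periodic s e p) (sym eq) per))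

  m≤a : ∀ y → m ≤ a y
  m≤a zero = ≤-refl
  m≤a (suc y) = m≤m⊔n m _

  C≤a : ∀ k → 1 ≤ k → C (pre k) ≤ a k
  C≤a k k≥1 = subst (C (pre k) ≤_) (sym (a≡m⊔C k k≥1)) (m≤n⊔m m _)

  C≤m⇒a≡m : ∀ k → 1 ≤ k → C (pre k) ≤ m → a k ≡ m
  C≤m⇒a≡m k k≥1 le = trans (a≡m⊔C k k≥1) (m≥n⇒m⊔n≡m le)

  m<a⇒a≡C : ∀ k → 1 ≤ k → m < a k → a k ≡ C (pre k)
  m<a⇒a≡C k k≥1 lt with C (pre k) ≤? m
  ... | yes le = ⊥-elim (<-irrefl (sym (C≤m⇒a≡m k k≥1 le)) lt)
  ... | no nle = trans (a≡m⊔C k k≥1) (m≤n⇒m⊔n≡n (<⇒≤ (≰⇒> nle)))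

  a≡m⇒C≤m : ∀ k → 1 ≤ k → a k ≡ m → C (pre k) ≤ m
  a≡m⇒C≤m k k≥1 eq = subst (C (pre k) ≤_) eq (C≤a k k≥1)

  periods≤a-last : ∀ s p r → 1 ≤ p → Periodic s (s + suc r * p) p → ∀ y → s + r * p ≤ y → y < s + suc r * p → r ≤ a y
  periods≤a-last s p zero p≥1 per y le yx = z≤n
  periods≤a-last s p (suc r') p≥1 per y le' yx with ≤⇒≡+ le'
  ... | (w , yeq) = ≤-trans (periods≤C y (s + w) p (suc r') p≥1 eqy
                          (Periodic-restrict per (m≤m+n s w) (<⇒≤ yx))) (C≤a y y≥1)
        where
          eqy : s + w + suc r' * p ≡ y
          eqy = trans (+-assoc s w _) (trans (cong (s +_) (+-comm w _)) (trans (sym (+-assoc s _ w)) (sym yeq)))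
          y≥1 : 1 ≤ y
          y≥1 = ≤-trans p≥1 (≤-trans (m≤m+n p (r' * p)) (≤-trans (m≤n+m _ s) le'))

  periods≤a : ∀ s p r → 1 ≤ p → Periodic s (s + r * p) p → ∀ y → s ≤ y → y < s + r * p → pred r ≤ a y
  periods≤a s p zero _ _ _ _ _ = z≤n
  periods≤a s p (suc r) p≥1 per y0 sy0 yx0 = aux r y0 sy0 (+-monoˡ-≤ (r * p) sy0) yx0
    where
      x : ℕ
      x = s + suc r * p
      last : ∀ y → s + r * p ≤ y → y < x → r ≤ a y
      last = periods≤a-last s p r p≥1 per
      aux : ∀ j y → s ≤ y → s + r * p ≤ y + j * p → y < x → r ≤ a y
      aux j y sy le yx with (s + r * p) ≤? y
      ... | yes le2 = last y le2 yx
      aux zero y sy le yx | no nle = ⊥-elim (nle (subst (s + r * p ≤_) (+-identityʳ y) le))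
      aux (suc j) y sy le yx | no nle =
        subst (r ≤_) (sym eqa) (aux j (y + p) (≤-trans sy (m≤m+n y p))
               (subst (s + r * p ≤_) (x+[y+zy]≡x+y+zy y p j) le) ypx)
        where
          ypx : y + p < x
          ypx = subst (y + p <_) (x+yz+z≡x+[z+yz] s r p) (+-monoˡ-< p (≰⇒> nle))
          eqa : a y ≡ a (y + p)
          eqa = per y sy ypx

  C-copy-≥ : ∀ T c → 1 ≤ c → (∀ z → z < c → a (T + z) ≡ a z) → C (pre c) ≤ C (pre (T + c))
  C-copy-≥ T c c≥1 hyp with C-period c c≥1
  ... | (p , s₀ , p≥1 , eq₀ , per₀) =
    periods≤C (T + c) (T + s₀) p (C (pre c)) p≥1 (trans (+-assoc T s₀ _) (cong (T +_) eq₀)) shifted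
    where
      shifted : Periodic (T + s₀) (T + c) p
      shifted y le yp with ≤⇒≡+ (≤-trans (m≤m+n T s₀) le)
      ... | (z , refl) = begin
           a (T + z) ≡⟨ hyp z z<c ⟩
           a z ≡⟨ per₀ z (+-cancelˡ-≤ T s₀ z le) zp ⟩
           a (z + p) ≡⟨ sym (hyp (z + p) zp) ⟩
           a (T + (z + p)) ≡⟨ cong a (sym (+-assoc T z p)) ⟩
           a (T + z + p) ∎
        where
          open ≡-Reasoning
          zp : z + p < c
          zp = +-cancelˡ-< T (z + p) c (subst (_< T + c) (+-assoc T z p) yp)
          z<c : z < c
          z<c = ≤-<-trans (m≤m+n z p) zp

  -- A repetition Y^r ending at T + c either lies inside the copy of a(0..c-1), or it reaches back
  -- past T, in which case a T = m bounds r by m + 1 ≤ a c.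
  C-copy-≤ : ∀ T c → 1 ≤ c → (∀ z → z < c → a (T + z) ≡ a z) → m < a c → C (pre (T + c)) ≤ C (pre c)
  C-copy-≤ T c c≥1 hyp ac>m with C-period (T + c) (≤-trans c≥1 (m≤n+m c T))
  ... | (p , s₁ , p≥1 , eq₁ , per₁) with T ≤? s₁
  ... | yes Ts with ≤⇒≡+ Ts
  ... | (z₀ , refl) = periods≤C c z₀ p (C (pre (T + c))) p≥1
          (+-cancelˡ-≡ T _ _ (trans (sym (+-assoc T z₀ _)) eq₁)) unshifted
    where
      unshifted : Periodic z₀ c p
      unshifted z le zp = begin
           a z ≡⟨ sym (hyp z (≤-<-trans (m≤m+n z p) zp)) ⟩
           a (T + z) ≡⟨ per₁ (T + z) (+-monoʳ-≤ T le) (subst (_< T + c) (sym (+-assoc T z p)) (+-monoʳ-< T zp)) ⟩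
           a (T + z + p) ≡⟨ cong a (+-assoc T z p) ⟩
           a (T + (z + p)) ≡⟨ hyp (z + p) zp ⟩
           a (z + p) ∎
        where open ≡-Reasoning
  C-copy-≤ T c c≥1 hyp ac>m | (p , s₁ , p≥1 , eq₁ , per₁) | no nTs = begin
      C (pre (T + c))         ≡⟨ suc-pred r {{>-nonZero r≥1}} ⟨
      suc (pred r)            ≤⟨ s≤s (subst (pred r ≤_) aT pred-r≤aT) ⟩
      suc m                   ≤⟨ ac>m ⟩
      a c                     ≡⟨ m<a⇒a≡C c c≥1 ac>m ⟩
      C (pre c)               ∎
    where
      open ≤-Reasoning
      r : ℕ
      r = C (pre (T + c))
      r≥1 : 1 ≤ r
      r≥1 = proj₁ (hC (pre (T + c)) (pre≢[] (T + c) (≤-trans c≥1 (m≤n+m c T))))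
      pred-r≤aT : pred r ≤ a T
      pred-r≤aT = periods≤a s₁ p r p≥1 (subst (λ e → Periodic s₁ e p) (sym eq₁) per₁) T (<⇒≤ (≰⇒> nTs))
             (subst (T <_) (sym eq₁) (subst (_< T + c) (+-identityʳ T) (+-monoʳ-< T c≥1)))
      aT : a T ≡ m
      aT = trans (cong a (sym (+-identityʳ T))) (hyp 0 c≥1)

  a-copy : ∀ T c → 1 ≤ c → (∀ z → z < c → a (T + z) ≡ a z) → m < a c → a (T + c) ≡ a c
  a-copy T c c≥1 hyp ac>m = begin
      a (T + c)            ≡⟨ a≡m⊔C (T + c) (≤-trans c≥1 (m≤n+m c T)) ⟩
      m ⊔ C (pre (T + c))  ≡⟨ cong (m ⊔_) (≤-antisym (C-copy-≤ T c c≥1 hyp ac>m) (C-copy-≥ T c c≥1 hyp)) ⟩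
      m ⊔ C (pre c)        ≡⟨ a≡m⊔C c c≥1 ⟨
      a c                  ∎
    where open ≡-Reasoning

module Valuation (m : ℕ) (m≥1 : 1 ≤ m) where
  b : ℕ
  b = suc m

  b≥2 : 2 ≤ b
  b≥2 = s≤s m≥1

  -- ν i is the exponent of b in i, computed with fuel i; ν 0 = 0 is junk, and the lemmas assume 1 ≤ i.
  νFuel : ℕ → ℕ → ℕ
  νFuel zero i = 0
  νFuel (suc f) i with b ∣? i
  ... | yes (divides q _) = suc (νFuel f q)
  ... | no _ = 0

  ν : ℕ → ℕ
  ν i = νFuel i i

  ^-∣-mono : ∀ {x y} → x ≤ y → b ^ x ∣ b ^ y
  ^-∣-mono {x} le with ≤⇒≡+ le
  ... | (z , refl) = divides (b ^ z) (trans (^-distribˡ-+-* b x z) (*-comm (b ^ x) (b ^ z)))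

  b^n≥1 : ∀ n → 1 ≤ b ^ n
  b^n≥1 n = m^n>0 b n

  *b≥1⇒≥1 : ∀ q → 1 ≤ q * b → 1 ≤ q
  *b≥1⇒≥1 zero h = h
  *b≥1⇒≥1 (suc q) _ = s≤s z≤n

  ν-spec : ∀ f i → 1 ≤ i → i ≤ f → (b ^ νFuel f i ∣ i) × ¬ (b ^ suc (νFuel f i) ∣ i)
  ν-spec zero i i≥1 le = ⊥-elim (<-irrefl refl (≤-trans i≥1 le))
  ν-spec (suc f) i i≥1 le with b ∣? i
  ... | no nd = 1∣ i , λ d → nd (subst (_∣ i) (*-identityʳ b) d)
  ... | yes (divides q eq) = d1 , nd1
    where
      q≥1 : 1 ≤ q
      q≥1 = *b≥1⇒≥1 q (subst (1 ≤_) eq i≥1)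
      q<i : q < i
      q<i = subst (q <_) (sym eq) (<-≤-trans (subst (_< q * 2) (*-identityʳ q) (*-monoʳ-< q {{>-nonZero q≥1}} (s≤s (s≤s z≤n))))
                 (*-monoʳ-≤ q b≥2))
      ih : (b ^ νFuel f q ∣ q) × ¬ (b ^ suc (νFuel f q) ∣ q)
      ih = ν-spec f q q≥1 (≤-pred (≤-trans q<i le))
      d1 : b ^ suc (νFuel f q) ∣ i
      d1 = subst (_∣ i) (*-comm (b ^ νFuel f q) b) (subst (b ^ νFuel f q * b ∣_) (sym eq) (*-monoˡ-∣ b (proj₁ ih)))
      nd1 : ¬ (b ^ suc (suc (νFuel f q)) ∣ i)
      nd1 d = proj₂ ih (*-cancelʳ-∣ b (subst₂ _∣_ (*-comm b (b ^ suc (νFuel f q))) eq d))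

  ν-dvd : ∀ i → 1 ≤ i → b ^ ν i ∣ i
  ν-dvd i i≥1 = proj₁ (ν-spec i i i≥1 ≤-refl)

  ν-ndvd : ∀ i → 1 ≤ i → ¬ (b ^ suc (ν i) ∣ i)
  ν-ndvd i i≥1 = proj₂ (ν-spec i i i≥1 ≤-refl)

  ν-ge : ∀ i k → 1 ≤ i → b ^ k ∣ i → k ≤ ν i
  ν-ge i k i≥1 d with k ≤? ν i
  ... | yes le = le
  ... | no nle = ⊥-elim (ν-ndvd i i≥1 (∣-trans (^-∣-mono (≰⇒> nle)) d))

  ν-lt : ∀ i k → 1 ≤ i → ¬ (b ^ k ∣ i) → ν i < k
  ν-lt i k i≥1 nd with ν i <? k
  ... | yes lt = lt
  ... | no nlt = ⊥-elim (nd (∣-trans (^-∣-mono (≮⇒≥ nlt)) (ν-dvd i i≥1)))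

  ≤ν⇒∣ : ∀ i k → 1 ≤ i → k ≤ ν i → b ^ k ∣ i
  ≤ν⇒∣ i k i≥1 le = ∣-trans (^-∣-mono le) (ν-dvd i i≥1)

  ν-+-multiple : ∀ t r k → b ^ k ∣ t → 1 ≤ r → ¬ (b ^ k ∣ r) → ν (t + r) ≡ ν r
  ν-+-multiple t r k dt r≥1 ndr = ≤-antisym le2 le1
    where
      e = ν r
      e<k : e < k
      e<k = ν-lt r k r≥1 ndr
      tr≥1 : 1 ≤ t + r
      tr≥1 = ≤-trans r≥1 (m≤n+m r t)
      le1 : e ≤ ν (t + r)
      le1 = ν-ge (t + r) e tr≥1 (∣m∣n⇒∣m+n (∣-trans (^-∣-mono (<⇒≤ e<k)) dt) (ν-dvd r r≥1))
      le2 : ν (t + r) ≤ e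
      le2 with ν (t + r) ≤? e
      ... | yes le = le
      ... | no nle = ⊥-elim (ν-ndvd r r≥1 (∣m+n∣m⇒∣n (≤ν⇒∣ (t + r) (suc e) tr≥1 (≰⇒> nle)) (∣-trans (^-∣-mono e<k) dt)))

  ν-+-higher : ∀ z d → 1 ≤ z → 1 ≤ d → ν d < ν z → ν (z + d) ≡ ν d
  ν-+-higher z d z≥1 d≥1 lt = ν-+-multiple z d (suc (ν d)) (≤ν⇒∣ z (suc (ν d)) z≥1 lt) d≥1 (ν-ndvd d d≥1)

  ν-+-higher⁻¹ : ∀ w d → 1 ≤ w → 1 ≤ d → ν d < ν (w + d) → ν w ≡ ν d
  ν-+-higher⁻¹ w d w≥1 d≥1 lt with <-cmp (ν w) (ν d)
  ... | tri≈ _ eq _ = eq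
  ... | tri> _ _ gt = ⊥-elim (<-irrefl (sym (ν-+-higher w d w≥1 d≥1 gt)) lt)
  ... | tri< lt2 _ _ = ⊥-elim (<-asym lt2 (subst (ν d <_) (trans (cong ν (+-comm w d)) (ν-+-higher d w d≥1 w≥1 lt2)) lt))

  ν-pow : ∀ n → ν (b ^ n) ≡ n
  ν-pow n = ≤-antisym (≤-pred (ν-lt (b ^ n) (suc n) (b^n≥1 n) nd)) (ν-ge (b ^ n) n (b^n≥1 n) ∣-refl)
    where
      nd : ¬ (b ^ suc n ∣ b ^ n)
      nd d = <⇒≱ (^-monoʳ-< b b≥2 (n<1+n n)) (∣⇒≤⁺ d (b^n≥1 n))

  ν-bound : ∀ i k → 1 ≤ i → i < b ^ k → ν i < k
  ν-bound i k i≥1 lt = ν-lt i k i≥1 (λ d → <⇒≱ lt (∣⇒≤⁺ d i≥1))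

  ν-mult : ∀ c n → 1 ≤ c → c < b → ν (c * b ^ n) ≡ n
  ν-mult c n c≥1 c<b = ≤-antisym (≤-pred (ν-lt _ (suc n) cb≥1 nd)) (ν-ge _ n cb≥1 (∣n⇒∣m*n c ∣-refl))
    where
      cb≥1 : 1 ≤ c * b ^ n
      cb≥1 = *-mono-≤ c≥1 (b^n≥1 n)
      nd : ¬ (b ^ suc n ∣ c * b ^ n)
      nd d = <⇒≱ c<b (∣⇒≤⁺ (*-cancelʳ-∣ (b ^ n) {{>-nonZero (b^n≥1 n)}} d) c≥1)

  multiple-in-window : ∀ M → 1 ≤ M → ∀ s → Σ ℕ λ z → s ≤ z × z < s + M × M ∣ z
  multiple-in-window M M≥1 zero = 0 , z≤n , M≥1 , divides 0 refl
  multiple-in-window M M≥1 (suc s) with multiple-in-window M M≥1 s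
  ... | (z , sz , zlt , d) with z ≟ s
  ... | yes refl = z + M , subst (_≤ z + M) (+-comm z 1) (+-monoʳ-≤ z M≥1) , n<1+n (z + M) , ∣m∣n⇒∣m+n d ∣-refl
  ... | no z≢s = z , ≤∧≢⇒< sz (λ eq → z≢s (sym eq)) , ≤-trans zlt (n≤1+n (s + M)) , d

  b^sucν≤b* : ∀ d → 1 ≤ d → b ^ suc (ν d) ≤ b * d
  b^sucν≤b* d d≥1 = *-monoʳ-≤ b (∣⇒≤⁺ (ν-dvd d d≥1) d≥1)

  ν-shift-breaks : ∀ y d → 1 ≤ y → 1 ≤ d → b ^ suc (ν d) ∣ y → ν y ≢ ν (y + d)
  ν-shift-breaks y d y≥1 d≥1 dv e = <⇒≢ νy (sym (trans e (ν-+-higher y d y≥1 d≥1 νy)))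
    where
      νy : ν d < ν y
      νy = ν-ge y (suc (ν d)) y≥1 dv

  ν-shift-breaks⁻ : ∀ y d → 1 ≤ y → 1 ≤ d → b ^ suc (ν d) ∣ y + d → ν y ≢ ν (y + d)
  ν-shift-breaks⁻ y d y≥1 d≥1 dv e = <⇒≢ νyd (trans (sym (ν-+-higher⁻¹ y d y≥1 d≥1 νyd)) e)
    where
      νyd : ν d < ν (y + d)
      νyd = ν-ge (y + d) (suc (ν d)) (≤-trans d≥1 (m≤n+m d y)) dv

  -- The window [s, s + b·d) contains a multiple z of b^(ν d + 1); the hypothesis equates ν z with
  -- the valuation of z + d or of z ∸ d, which is ν d.
  ¬ν-shift-periodic : ∀ s d → 1 ≤ s → 1 ≤ d → (∀ j → j < m * d → ν (s + j) ≡ ν (s + j + d)) → ⊥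
  ¬ν-shift-periodic s d s≥1 d≥1 h with multiple-in-window (b ^ suc (ν d)) (b^n≥1 (suc (ν d))) s
  ... | (z , sz , zlt , Mz) with ≤⇒≡+ sz
  ... | (j₀ , refl) with j₀ <? m * d
  ... | yes lt = ν-shift-breaks (s + j₀) d (≤-trans s≥1 sz) d≥1 Mz (h j₀ lt)
  ... | no nlt with ≤⇒≡+ (≤-trans (subst (_≤ m * d) (*-identityˡ d) (*-monoˡ-≤ d m≥1)) (≮⇒≥ nlt))
  ... | (j₁ , refl) =
    ν-shift-breaks⁻ (s + j₁) d (≤-trans s≥1 (m≤m+n s j₁)) d≥1 (subst (b ^ suc (ν d) ∣_) (sym zeq) Mz) (h j₁ j₁lt)
    where
      zeq : s + j₁ + d ≡ s + (d + j₁)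
      zeq = trans (+-assoc s j₁ d) (cong (s +_) (+-comm j₁ d))
      j₁lt : j₁ < m * d
      j₁lt = +-cancelˡ-< d j₁ (m * d) (+-cancelˡ-< s (d + j₁) (d + m * d) (<-≤-trans zlt (+-monoʳ-≤ s (b^sucν≤b* d d≥1))))

  -- As above, with the shift equation only below J = s + m·d ∸ 1 and failing at J: the argument
  -- then escapes only for m = 1, with z = J.
  ν-shift-periodic⇒m≡1 : ∀ s d J → 1 ≤ s → 1 ≤ d → s + m * d ≡ suc J → (∀ j → suc j < m * d → ν (s + j) ≡ ν (s + j + d))
                         → ν (J + d) < ν J → (m ≡ 1) × (ν d < ν J)
  ν-shift-periodic⇒m≡1 s d J s≥1 d≥1 sJ h hJ with multiple-in-window (b ^ suc (ν d)) (b^n≥1 (suc (ν d))) s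
  ... | (z , sz , zlt , Mz) with ≤⇒≡+ sz
  ... | (j₀ , refl) = cases
    where
      z≥1 : 1 ≤ s + j₀
      z≥1 = ≤-trans s≥1 sz
      νz : ν d < ν (s + j₀)
      νz = ν-ge (s + j₀) (suc (ν d)) z≥1 Mz
      j₀<bd : j₀ < d + m * d
      j₀<bd = +-cancelˡ-< s j₀ (d + m * d) (<-≤-trans zlt (+-monoʳ-≤ s (b^sucν≤b* d d≥1)))
      J≥1 : 1 ≤ J
      J≥1 = ≤-trans s≥1 (≤-pred (subst (suc s ≤_) sJ (subst (_≤ s + m * d) (+-comm s 1) (+-monoʳ-≤ s (*-mono-≤ m≥1 d≥1)))))
      cases : (m ≡ 1) × (ν d < ν J)
      cases with suc j₀ <? m * d
      ... | yes lt = ⊥-elim (ν-shift-breaks (s + j₀) d z≥1 d≥1 Mz (h j₀ lt))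
      ... | no nlt with suc j₀ ≟ d + m * d
      ... | yes last = ⊥-elim (<-asym hJ (subst (_< ν (J + d)) (sym νJ) (subst (λ t → ν d < ν t) zJ νz)))
        where
          zJ : s + j₀ ≡ J + d
          zJ = suc-injective (trans (sym (+-suc s j₀)) (trans (cong (s +_) last)
                 (trans (cong (s +_) (+-comm d (m * d))) (trans (sym (+-assoc s (m * d) d)) (cong (_+ d) sJ)))))
          νJ : ν J ≡ ν d
          νJ = ν-+-higher⁻¹ J d J≥1 d≥1 (subst (λ t → ν d < ν t) zJ νz)
      ... | no nlast with d ≤? j₀
      ... | yes dj with ≤⇒≡+ dj
      ... | (j₁ , refl) = ⊥-elim (ν-shift-breaks⁻ (s + j₁) d (≤-trans s≥1 (m≤m+n s j₁)) d≥1 (subst (b ^ suc (ν d) ∣_) (sym zeq) Mz) (h j₁ j₁lt))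
        where
          zeq : s + j₁ + d ≡ s + (d + j₁)
          zeq = trans (+-assoc s j₁ d) (cong (s +_) (+-comm j₁ d))
          j₁lt : suc j₁ < m * d
          j₁lt = +-cancelˡ-< d (suc j₁) (m * d) (subst (_< d + m * d) (sym (+-suc d j₁)) (≤∧≢⇒< j₀<bd nlast))
      cases | no nlt | no nlast | no ndj = m≡1 , subst (λ t → ν d < ν t) (sym Jz) νz
        where
          md≤d : m * d ≤ d
          md≤d = ≤-trans (≮⇒≥ nlt) (≰⇒> ndj)
          m≡1 : m ≡ 1
          m≡1 = ≤-antisym (*-cancelʳ-≤ m 1 d {{>-nonZero d≥1}} (subst (m * d ≤_) (sym (*-identityˡ d)) md≤d)) m≥1
          md≡d : m * d ≡ d
          md≡d = trans (cong (_* d) m≡1) (*-identityˡ d)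
          sj≡d : suc j₀ ≡ d
          sj≡d = ≤-antisym (≰⇒> ndj) (subst (_≤ suc j₀) md≡d (≮⇒≥ nlt))
          Jz : J ≡ s + j₀
          Jz = suc-injective (trans (sym sJ) (trans (cong (s +_) (trans md≡d (sym sj≡d))) (+-suc s j₀)))

module Units (m : ℕ) (m≥1 : 1 ≤ m) (ℓ : ℕ → ℕ) where
  open Valuation m m≥1 public

  -- Γ u is the length of S_1 ⋯ S_u.  Unit i starts at P i and has length U i: b copies of m,
  -- then the glues S_1, …, S_{νu i + 1}.  lam n is the length of B_{n+1}^(m).
  Γ : ℕ → ℕ
  Γ zero = 0
  Γ (suc u) = Γ u + ℓ u

  νu : ℕ → ℕ
  νu i = ν (suc i)

  U : ℕ → ℕ
  U i = b + Γ (suc (νu i))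

  P : ℕ → ℕ
  P zero = 0
  P (suc i) = P i + U i

  lam : ℕ → ℕ
  lam zero = 1
  lam (suc n) = P (b ^ n)

  Γ-mono : ∀ {u u'} → u ≤ u' → Γ u ≤ Γ u'
  Γ-mono {u} le with ≤⇒≡+ le
  ... | (k , refl) = go u k
    where
      go : ∀ u k → Γ u ≤ Γ (u + k)
      go u zero = ≤-reflexive (cong Γ (sym (+-identityʳ u)))
      go u (suc k) = ≤-trans (go u k) (≤-trans (m≤m+n (Γ (u + k)) (ℓ (u + k))) (≤-reflexive (cong Γ (sym (+-suc u k)))))

  Γ-strict : ∀ N → (∀ u → u < N → 1 ≤ ℓ u) → ∀ {u u'} → u < u' → u' ≤ N → Γ u < Γ u'
  Γ-strict N ℓ≥1 {u} {suc u'} (s≤s le) u'N =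
    <-≤-trans (≤-<-trans (Γ-mono le) (subst (_< Γ u' + ℓ u') (+-identityʳ (Γ u')) (+-monoʳ-< (Γ u') (ℓ≥1 u' u'N)))) ≤-refl

  Γ-inj : ∀ N → (∀ u → u < N → 1 ≤ ℓ u) → ∀ {u u'} → u ≤ N → u' ≤ N → Γ u ≡ Γ u' → u ≡ u'
  Γ-inj N ℓ≥1 {u} {u'} uN u'N eq with <-cmp u u'
  ... | tri≈ _ e _ = e
  ... | tri< lt _ _ = ⊥-elim (<-irrefl eq (Γ-strict N ℓ≥1 lt u'N))
  ... | tri> _ _ gt = ⊥-elim (<-irrefl (sym eq) (Γ-strict N ℓ≥1 gt uN))

  b≤U : ∀ i → b ≤ U i
  b≤U i = m≤m+n b _

  b<U : 1 ≤ ℓ 0 → ∀ i → b < U i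
  b<U ℓ0≥1 i = subst (_< U i) (+-identityʳ b) (+-monoʳ-< b (≤-trans ℓ0≥1 (Γ-mono {1} (s≤s z≤n))))

  P-mono : ∀ {i j} → i ≤ j → P i ≤ P j
  P-mono {i} le with ≤⇒≡+ le
  ... | (k , refl) = go i k
    where
      go : ∀ i k → P i ≤ P (i + k)
      go i zero = ≤-reflexive (cong P (sym (+-identityʳ i)))
      go i (suc k) = ≤-trans (go i k) (≤-trans (m≤m+n (P (i + k)) (U (i + k))) (≤-reflexive (cong P (sym (+-suc i k)))))

  P-suc≥ : ∀ {i j} → i < j → P i + U i ≤ P j
  P-suc≥ {i} lt = P-mono lt

  P-strict : ∀ {i j} → i < j → P i + b ≤ P j
  P-strict {i} lt = ≤-trans (+-monoʳ-≤ (P i) (b≤U i)) (P-suc≥ lt)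

  P-reflects-< : ∀ {i j} → P i < P j → i < j
  P-reflects-< {i} {j} lt with i <? j
  ... | yes l = l
  ... | no nl = ⊥-elim (<-irrefl refl (<-≤-trans lt (P-mono (≮⇒≥ nl))))

  P-inj : ∀ {i j} → P i ≡ P j → i ≡ j
  P-inj {i} {j} eq with <-cmp i j
  ... | tri≈ _ e _ = e
  ... | tri< lt _ _ = ⊥-elim (<-irrefl eq (<-≤-trans (subst (_< P i + b) (+-identityʳ (P i)) (+-monoʳ-< (P i) (s≤s z≤n))) (P-strict lt)))
  ... | tri> _ _ gt = ⊥-elim (<-irrefl (sym eq) (<-≤-trans (subst (_< P j + b) (+-identityʳ (P j)) (+-monoʳ-< (P j) (s≤s z≤n))) (P-strict gt)))

  unit-containing : ∀ y → Σ ℕ λ i → P i ≤ y × y < P (suc i)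
  unit-containing zero = 0 , z≤n , <-≤-trans (s≤s z≤n) (b≤U 0)
  unit-containing (suc y) with unit-containing y
  ... | (i , le , lt) with suc y <? P (suc i)
  ... | yes lt' = i , ≤-trans le (n≤1+n y) , lt'
  ... | no nlt = suc i , ≮⇒≥ nlt , subst (_< P (suc (suc i))) (sym eq) (m<m+n (P (suc i)) (<-≤-trans (s≤s z≤n) (b≤U (suc i))))
    where
      eq : suc y ≡ P (suc i)
      eq = ≤-antisym lt (≮⇒≥ nlt)

  b^n≡suc : ∀ n → Σ ℕ λ q → b ^ n ≡ suc q
  b^n≡suc n with b ^ n | b^n≥1 n
  ... | suc q | _ = q , refl

  P-+ : ∀ k t r → b ^ k ∣ t → r < b ^ k → P (t + r) ≡ P t + P r
  P-+ k t zero d lt = trans (cong P (+-identityʳ t)) (sym (+-identityʳ (P t)))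
  P-+ k t (suc r) d lt = begin
      P (t + suc r) ≡⟨ cong P (+-suc t r) ⟩
      P (t + r) + U (t + r) ≡⟨ cong₂ _+_ (P-+ k t r d (<-trans (n<1+n r) lt)) Ueq ⟩
      P t + P r + U r ≡⟨ +-assoc (P t) (P r) (U r) ⟩
      P t + P (suc r) ∎
    where
      open ≡-Reasoning
      νeq : ν (suc (t + r)) ≡ ν (suc r)
      νeq = trans (cong ν (sym (+-suc t r))) (ν-+-multiple t (suc r) k d (s≤s z≤n) (λ dd → <⇒≱ lt (∣⇒≤⁺ dd (s≤s z≤n))))
      Ueq : U (t + r) ≡ U r
      Ueq = cong (λ v → b + Γ (suc v)) νeq

  P-*′ : ∀ c n q → b ^ n ≡ suc q → c < b → P (c * suc q) ≡ c * P (suc q)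
  P-*′ zero n q eq lt = refl
  P-*′ (suc c) n q eq lt = begin
      P (suc c * suc q) ≡⟨ cong P e1 ⟩
      P (suc (c * suc q + q)) ≡⟨ refl ⟩
      P (c * suc q + q) + U (c * suc q + q) ≡⟨ cong₂ _+_ (P-+ n (c * suc q) q dv (subst (q <_) (sym eq) (n<1+n q))) Ueq ⟩
      P (c * suc q) + P q + U q ≡⟨ cong (λ z → z + P q + U q) (P-*′ c n q eq (<-trans (n<1+n c) lt)) ⟩
      c * P (suc q) + P q + U q ≡⟨ +-assoc (c * P (suc q)) (P q) (U q) ⟩
      c * P (suc q) + P (suc q) ≡⟨ +-comm (c * P (suc q)) (P (suc q)) ⟩
      suc c * P (suc q) ∎
    where
      open ≡-Reasoning
      e1 : suc c * suc q ≡ suc (c * suc q + q)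
      e1 = cong suc (+-comm q (c * suc q))
      dv : b ^ n ∣ c * suc q
      dv = subst (λ z → z ∣ c * suc q) (sym eq) (∣n⇒∣m*n c ∣-refl)
      ν1 : ν (suc (c * suc q + q)) ≡ n
      ν1 = trans (cong ν (sym e1)) (trans (cong (λ z → ν (suc c * z)) (sym eq)) (ν-mult (suc c) n (s≤s z≤n) lt))
      ν2 : ν (suc q) ≡ n
      ν2 = trans (cong ν (sym eq)) (ν-pow n)
      Ueq : U (c * suc q + q) ≡ U q
      Ueq = cong (λ v → b + Γ (suc v)) (trans ν1 (sym ν2))

  P-* : ∀ c n → c < b → P (c * b ^ n) ≡ c * lam (suc n)
  P-* c n lt with b^n≡suc n
  ... | (q , eq) = subst (λ z → P (c * z) ≡ c * P z) (sym eq) (P-*′ c n q eq lt)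

  νu-pow : ∀ n q → b ^ n ≡ suc q → νu q ≡ n
  νu-pow n q eq = trans (cong ν (sym eq)) (ν-pow n)

  b*lam≡ : ∀ n q → b ^ n ≡ suc q → b * lam n ≡ P q + b + Γ n
  b*lam≡ zero zero eq = trans (*-identityʳ b) (sym (+-identityʳ b))
  b*lam≡ zero (suc q) ()
  b*lam≡ (suc n') q eq with b^n≡suc n'
  ... | (q' , eq') = begin
      b * lam (suc n') ≡⟨ +-comm (lam (suc n')) (m * lam (suc n')) ⟩
      m * lam (suc n') + lam (suc n') ≡⟨ cong (m * lam (suc n') +_) Leq ⟩
      m * lam (suc n') + (P q' + b + Γ (suc n')) ≡⟨ sym (+-assoc (m * lam (suc n')) (P q' + b) _) ⟩
      m * lam (suc n') + (P q' + b) + Γ (suc n') ≡⟨ cong (_+ Γ (suc n')) (sym (+-assoc (m * lam (suc n')) (P q') b)) ⟩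
      m * lam (suc n') + P q' + b + Γ (suc n') ≡⟨ cong (λ z → z + b + Γ (suc n')) (sym Pq) ⟩
      P q + b + Γ (suc n') ∎
    where
      open ≡-Reasoning
      qeq : q ≡ m * suc q' + q'
      qeq = suc-injective (trans (sym eq) (trans (cong (b *_) eq') (cong suc (+-comm q' (m * suc q')))))
      Pq : P q ≡ m * lam (suc n') + P q'
      Pq = trans (cong P qeq) (trans (P-+ n' (m * suc q') q' (subst (λ z → z ∣ m * suc q') (sym eq') (∣n⇒∣m*n m ∣-refl)) (subst (q' <_) (sym eq') (n<1+n q')))
             (cong (_+ P q') (trans (P-*′ m n' q' eq' (n<1+n m)) (cong (λ z → m * P z) (sym eq')))))
      Leq : lam (suc n') ≡ P q' + b + Γ (suc n')
      Leq = trans (cong P eq') (trans (cong (λ v → P q' + (b + Γ (suc v))) (νu-pow n' q' eq')) (sym (+-assoc (P q') b _)))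

  lam-suc : ∀ n → lam (suc n) ≡ b * lam n + ℓ n
  lam-suc n with b^n≡suc n
  ... | (q , eq) = begin
      P (b ^ n) ≡⟨ cong P eq ⟩
      P q + (b + (Γ (suc (νu q)))) ≡⟨ cong (λ v → P q + (b + Γ (suc v))) (νu-pow n q eq) ⟩
      P q + (b + (Γ n + ℓ n)) ≡⟨ x+[y+[z+w]]≡x+y+z+w (P q) b (Γ n) (ℓ n) ⟩
      P q + b + Γ n + ℓ n ≡⟨ cong (_+ ℓ n) (sym (b*lam≡ n q eq)) ⟩
      b * lam n + ℓ n ∎
    where
      open ≡-Reasoning

  glue-piece : ∀ v k → k < Γ (suc v) → Σ ℕ λ u → u ≤ v × Σ ℕ λ k' → k ≡ Γ u + k' × k' < ℓ u
  glue-piece zero k lt = 0 , z≤n , k , refl , lt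
  glue-piece (suc v) k lt with k <? Γ (suc v)
  ... | yes lt' with glue-piece v k lt'
  ... | (u , uv , k' , eq , lt'') = u , m≤n⇒m≤1+n uv , k' , eq , lt''
  glue-piece (suc v) k lt | no nlt with ≤⇒≡+ (≮⇒≥ nlt)
  ... | (k' , refl) = suc v , ≤-refl , k' , refl , +-cancelˡ-< (Γ (suc v)) k' _ lt

module LayoutFacts (C : List ℕ → ℕ) (hC : ∀ U → U ≢ [] → IsCurling U (C U)) (m : ℕ) (m≥1 : 1 ≤ m) where
  open CurlingFacts C hC m m≥1 hiding (b)

  module Layout (ℓ : ℕ → ℕ) where
    open Units m m≥1 ℓ

    -- Inside glue S_{u+1} a unit repeats the first occurrence of S_{u+1}, which follows B_{u+1}^b.
    Model : ℕ → Set
    Model x = (∀ i o → x ≡ P i + o → o < b → a x ≡ m)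
            × (∀ i u k → x ≡ P i + b + Γ u + k → u ≤ νu i → k < ℓ u → a x ≡ a (b * lam u + k))

    -- After B_{u+1}^b, A^(m) has exactly ℓ u entries above m and then m: S_{u+1} has length ℓ u.
    ValidGlue : ℕ → Set
    ValidGlue u = (1 ≤ ℓ u) × (∀ k → k < ℓ u → m < a (b * lam u + k)) × (a (b * lam u + ℓ u) ≡ m)

    ValidGlues : ℕ → Set
    ValidGlues N = ∀ u → u < N → ValidGlue u

    IsM : ℕ → Set
    IsM y = a y ≡ m

    module StepContext (N : ℕ) (gv : ValidGlues (suc N)) (x : ℕ) (xb : x < b * lam (suc N)) (IH : ∀ y → y < x → Model y) where

      ℓ≥1 : ∀ u → u < suc N → 1 ≤ ℓ u
      ℓ≥1 u lt = proj₁ (gv u lt)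

      ℓ0≥1 : 1 ≤ ℓ 0
      ℓ0≥1 = ℓ≥1 0 (s≤s z≤n)

      qN : ℕ
      qN = proj₁ (b^n≡suc (suc N))
      eqN : b ^ suc N ≡ suc qN
      eqN = proj₂ (b^n≡suc (suc N))

      xb' : x < P qN + b + Γ (suc N)
      xb' = subst (x <_) (b*lam≡ (suc N) qN eqN) xb

      glue-index-bound : ∀ j u k → P j + b + Γ u + k < x → u ≤ νu j → u < suc N
      glue-index-bound j u k lt uν with suc j <? b ^ suc N
      ... | yes sj = ≤-<-trans uν (ν-bound (suc j) (suc N) (s≤s z≤n) sj)
      ... | no nsj with u <? suc N
      ... | yes ok = ok
      ... | no nok = ⊥-elim (<-irrefl refl (<-≤-trans xb' (≤-trans le (<⇒≤ lt))))
        where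
          qj : qN ≤ j
          qj = ≤-pred (subst (_≤ suc j) eqN (≮⇒≥ nsj))
          le : P qN + b + Γ (suc N) ≤ P j + b + Γ u + k
          le = ≤-trans (+-mono-≤ (+-monoˡ-≤ b (P-mono qj)) (Γ-mono (≮⇒≥ nok))) (m≤m+n _ k)

      run-IsM : ∀ j o → P j + o < x → o < b → IsM (P j + o)
      run-IsM j o lt ob = proj₁ (IH (P j + o) lt) j o refl ob

      glue-¬IsM : ∀ j g → P j + b + g < x → g < Γ (suc (νu j)) → ¬ IsM (P j + b + g)
      glue-¬IsM j g lt gl eqm with glue-piece (νu j) g gl
      ... | (u , uν , k , refl , kl) = <-irrefl (sym eqm)
             (subst (m <_) (sym eqa) (proj₁ (proj₂ (gv u (glue-index-bound j u k lt' uν))) k kl))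
        where
          lt' : P j + b + Γ u + k < x
          lt' = subst (_< x) (sym (+-assoc (P j + b) (Γ u) k)) lt
          eqa : a (P j + b + (Γ u + k)) ≡ a (b * lam u + k)
          eqa = proj₂ (IH _ lt) j u k (sym (+-assoc (P j + b) (Γ u) k)) uν kl

      run-or-glue : ∀ y → (Σ ℕ λ j → Σ ℕ λ o → y ≡ P j + o × o < b) ⊎ (Σ ℕ λ j → Σ ℕ λ g → y ≡ P j + b + g × g < Γ (suc (νu j)))
      run-or-glue y with unit-containing y
      ... | (j , le , lt) with ≤⇒≡+ le
      ... | (o , refl) with o <? b
      ... | yes ob = inj₁ (j , o , refl , ob)
      ... | no nob with ≤⇒≡+ (≮⇒≥ nob)
      ... | (g , refl) = inj₂ (j , g , sym (+-assoc (P j) b g) , +-cancelˡ-< b g _ (+-cancelˡ-< (P j) (b + g) _ lt))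

      IsM⇒run : ∀ y → y < x → IsM y → Σ ℕ λ j → Σ ℕ λ o → y ≡ P j + o × o < b
      IsM⇒run y yx ey with run-or-glue y
      ... | inj₁ r = r
      ... | inj₂ (j , g , refl , gl) = ⊥-elim (glue-¬IsM j g yx gl ey)

      ¬IsM⇒glue : ∀ y → y < x → ¬ IsM y → Σ ℕ λ j → Σ ℕ λ g → y ≡ P j + b + g × g < Γ (suc (νu j))
      ¬IsM⇒glue y yx ney with run-or-glue y
      ... | inj₂ r = r
      ... | inj₁ (j , o , refl , ob) = ⊥-elim (ney (run-IsM j o yx ob))

      Γs≥1 : ∀ v → 1 ≤ Γ (suc v)
      Γs≥1 v = ≤-trans ℓ0≥1 (Γ-mono {1} (s≤s z≤n))

      before-unit-¬IsM : ∀ j y → suc y ≡ P (suc j) → suc y ≤ x → ¬ IsM y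
      before-unit-¬IsM j y eq le with ≤⇒≡+ (Γs≥1 (νu j))
      ... | (g , geq) = subst (λ z → ¬ IsM z) (sym yeq) (glue-¬IsM j g (subst (_< x) yeq (≤-<-trans ≤-refl le)) (subst (g <_) (sym geq) (n<1+n g)))
        where
          yeq : y ≡ P j + b + g
          yeq = suc-injective (trans eq (trans (cong (λ z → P j + (b + z)) geq) (trans (sym (+-assoc (P j) b (suc g))) (+-suc (P j + b) g))))

      rise⇒unit-start : ∀ y → suc y < x → IsM (suc y) → ¬ IsM y → Σ ℕ λ j → suc y ≡ P j
      rise⇒unit-start y lt ey ney with IsM⇒run (suc y) lt ey
      ... | (j , zero , eq , _) = j , trans eq (+-identityʳ (P j))
      ... | (j , suc o , eq , ob) = ⊥-elim (ney (subst IsM (sym yeq) (run-IsM j o (subst (_< x) yeq (<-trans (n<1+n y) lt)) (<-trans (n<1+n o) ob))))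
        where
          yeq : y ≡ P j + o
          yeq = suc-injective (trans eq (+-suc (P j) o))

      fall⇒glue-start : ∀ y → suc y < x → ¬ IsM (suc y) → IsM y → Σ ℕ λ j → suc y ≡ P j + b
      fall⇒glue-start y lt ney ey with ¬IsM⇒glue (suc y) lt ney
      ... | (j , zero , eq , _) = j , trans eq (+-identityʳ (P j + b))
      ... | (j , suc g , eq , gl) = ⊥-elim (glue-¬IsM j g (subst (_< x) yeq (<-trans (n<1+n y) lt)) (<-trans (n<1+n g) gl) (subst IsM yeq ey))
        where
          yeq : y ≡ P j + b + g
          yeq = suc-injective (trans eq (+-suc (P j + b) g))

      P-<-suc : ∀ k → P k < P (suc k)
      P-<-suc k = <-≤-trans (subst (_< P k + b) (+-identityʳ (P k)) (+-monoʳ-< (P k) (s≤s z≤n))) (+-monoʳ-≤ (P k) (b≤U k))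

      lamNN : lam (suc (suc N)) ≡ P (suc qN)
      lamNN = cong P eqN

      νu-bound : ∀ j → P (suc j) ≤ x → νu j ≤ N
      νu-bound j le with suc j <? b ^ suc N
      ... | yes sj = ≤-pred (ν-bound (suc j) (suc N) (s≤s z≤n) sj)
      ... | no nsj = ⊥-elim (<-irrefl refl (<-≤-trans xb (≤-trans big (≤-trans (P-mono (s≤s qj)) le))))
        where
          qj : qN ≤ j
          qj = ≤-pred (subst (_≤ suc j) eqN (≮⇒≥ nsj))
          big : b * lam (suc N) ≤ P (suc qN)
          big = subst (b * lam (suc N) ≤_) (trans (sym (lam-suc (suc N))) lamNN) (m≤m+n _ _)

      U-injective : ∀ j j' → P (suc j) ≤ x → P (suc j') ≤ x → U j ≡ U j' → νu j ≡ νu j'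
      U-injective j j' l1 l2 eq = suc-injective (Γ-inj (suc N) ℓ≥1 (s≤s (νu-bound j l1)) (s≤s (νu-bound j' l2)) (+-cancelˡ-≡ b _ _ eq))

      module PeriodicTail (s p : ℕ) (p≥1 : 1 ≤ p) (sx : s + b * p ≡ x) (per : Periodic s x p) where

        IsM-shift : ∀ y → s ≤ y → y + p < x → IsM y → IsM (y + p)
        IsM-shift y sy yx ey = trans (sym (per y sy yx)) ey

        IsM-unshift : ∀ y → s ≤ y → y + p < x → IsM (y + p) → IsM y
        IsM-unshift y sy yx ey = trans (per y sy yx) ey

        a-shift-periods : ∀ j y → s ≤ y → y + j * p < x → a y ≡ a (y + j * p)
        a-shift-periods zero y sy lt = cong a (sym (+-identityʳ y))
        a-shift-periods (suc j) y sy lt = trans (per y sy (≤-<-trans (+-monoʳ-≤ y (m≤m+n p (j * p))) lt))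
                                 (trans (a-shift-periods j (y + p) (≤-trans sy (m≤m+n y p)) (subst (_< x) (sym (+-assoc y p (j * p))) lt))
                                   (cong a (+-assoc y p (j * p))))

        -- Shifted back by p, the start of unit j + 1 would be a unit start strictly inside unit i'.
        ¬unit-inside-shift : ∀ i' d j → s ≤ P i' + m → P (suc i') + p < x → P (suc i') + p ≡ P (suc i' + d)
                             → P j ≡ P i' + p → suc j ≤ i' + d → ⊥
        ¬unit-inside-shift i' d j sle lt eq Pj≡ j< =
          <-irrefl refl (<-≤-trans (P-reflects-< {i'} {j''} lo) (≤-pred (P-reflects-< {j''} {suc i'} hi)))
          where
            Γj : ℕ
            Γj = Γ (suc (νu j))
            Y' : ℕ
            Y' = P i' + (m + Γj)
            eZ : P (suc j) ≡ suc Y' + p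
            eZ = trans (cong (_+ U j) Pj≡) (x+y+suc[z+w]≡suc[x+[z+w]]+y (P i') p m Γj)
            PZx : P (suc j) < P (suc i') + p
            PZx = ≤-<-trans (P-mono j<) (subst (P (i' + d) <_) (sym eq) (P-<-suc (i' + d)))
            sY'x : suc Y' + p < x
            sY'x = subst (_< x) eZ (<-trans PZx lt)
            sY' : s ≤ Y'
            sY' = ≤-trans sle (+-monoʳ-≤ (P i') (m≤m+n m Γj))
            ey : IsM (suc Y')
            ey = IsM-unshift (suc Y') (≤-trans sY' (n≤1+n Y')) sY'x (subst IsM eZ eP)
              where
                Psjx : P (suc j) < x
                Psjx = subst (_< x) (sym eZ) sY'x
                eP : IsM (P (suc j))
                eP = subst IsM (+-identityʳ (P (suc j))) (run-IsM (suc j) 0 (subst (_< x) (sym (+-identityʳ (P (suc j)))) Psjx) (s≤s z≤n))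
            ney : ¬ IsM Y'
            ney eY = before-unit-¬IsM j (Y' + p) (sym eZ) (subst (_≤ x) refl (<⇒≤ (subst (_< x) refl sY'x))) (IsM-shift Y' sY' (<-trans (n<1+n _) sY'x) eY)
            j'' : ℕ
            j'' = proj₁ (rise⇒unit-start Y' (≤-<-trans (m≤m+n _ p) sY'x) ey ney)
            j''eq : suc Y' ≡ P j''
            j''eq = proj₂ (rise⇒unit-start Y' (≤-<-trans (m≤m+n _ p) sY'x) ey ney)
            lo : P i' < P j''
            lo = subst (P i' <_) j''eq (s≤s (m≤m+n (P i') _))
            hi : P j'' < P (suc i')
            hi = subst (_< P (suc i')) j''eq (+-cancelʳ-< p _ _ (subst (_< P (suc i') + p) eZ PZx))

        unit-shift-step : ∀ i' d → s ≤ P i' + m → P (suc i') + p < x → P (suc i') + p ≡ P (suc i' + d) → P i' + p ≡ P (i' + d)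
        unit-shift-step i' d sle lt eq = next-unit (fall⇒glue-start (P i' + m + p) gslt ngs egs)
          where
            y₁ : ℕ
            y₁ = P i' + m
            e1 : suc y₁ ≡ P i' + b
            e1 = sym (+-suc (P i') m)
            run<P : P i' + b < P (suc i')
            run<P = +-monoʳ-< (P i') (b<U ℓ0≥1 i')
            Psx : P (suc i') < x
            Psx = ≤-<-trans (m≤m+n _ p) lt
            gslt : suc (y₁ + p) < x
            gslt = subst (_< x) (sym (cong (_+ p) e1)) (<-trans (+-monoˡ-< p run<P) lt)
            egs : IsM (y₁ + p)
            egs = IsM-shift y₁ sle (<-trans (n<1+n _) gslt) (run-IsM i' m (<-trans (+-monoʳ-< (P i') (n<1+n m)) (<-trans run<P Psx)) (n<1+n m))
            ngs : ¬ IsM (suc (y₁ + p))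
            ngs ee = glue-¬IsM i' 0 (subst (_< x) (sym (+-identityʳ _)) (<-trans run<P Psx)) (Γs≥1 (νu i'))
                       (subst IsM (trans e1 (sym (+-identityʳ _))) (IsM-unshift (suc y₁) (≤-trans sle (n≤1+n y₁)) gslt ee))
            unit-start-shift : ∀ j → suc (y₁ + p) ≡ P j + b → P j ≡ P i' + p
            unit-start-shift j jeq = +-cancelʳ-≡ b _ _ (trans (sym jeq) (trans (cong (_+ p) e1) (trans (+-assoc (P i') b p) (trans (cong (P i' +_) (+-comm b p)) (sym (+-assoc (P i') p b))))))
            next-unit : Σ ℕ (λ j → suc (y₁ + p) ≡ P j + b) → P i' + p ≡ P (i' + d)
            next-unit (j , jeq) with j ≟ i' + d
            ... | yes e = trans (sym Pj≡) (cong P e)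
              where
                Pj≡ : P j ≡ P i' + p
                Pj≡ = unit-start-shift j jeq
            ... | no nj = ⊥-elim (¬unit-inside-shift i' d j sle lt eq Pj≡ (≤∧≢⇒< (≤-pred j<s) nj))
              where
                Pj≡ : P j ≡ P i' + p
                Pj≡ = unit-start-shift j jeq
                j<s : j < suc i' + d
                j<s = P-reflects-< (subst (_< P (suc i' + d)) (sym Pj≡) (subst (P i' + p <_) eq (+-monoˡ-< p (P-<-suc i'))))

        unit-shift-chain : ∀ i₀ i₁ d → (∀ i' → i₀ ≤ i' → s ≤ P i' + m) → P i₁ + p < x → P i₁ + p ≡ P (i₁ + d) → ∀ i' → i₀ ≤ i' → i' ≤ i₁ → P i' + p ≡ P (i' + d)
        unit-shift-chain i₀ i₁ d hs lt base i' le1 le2 = aux (proj₁ (≤⇒≡+ le2)) i' (sym (proj₂ (≤⇒≡+ le2))) le1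
          where
            aux : ∀ k i' → i' + k ≡ i₁ → i₀ ≤ i' → P i' + p ≡ P (i' + d)
            aux zero i' eq _ = subst (λ z → P z + p ≡ P (z + d)) (sym (trans (sym (+-identityʳ i')) eq)) base
            aux (suc k) i' eq le = unit-shift-step i' d (hs i' le) (≤-<-trans (+-monoˡ-≤ p (P-mono (subst (suc i' ≤_) eq (subst (_≤ i' + suc k) (+-comm i' 1) (+-monoʳ-≤ i' (s≤s z≤n)))))) lt)
                                     (aux k (suc i') (trans (sym (+-suc i' k)) eq) (≤-trans le (n≤1+n i')))

        unit-shift⇒ν≡ : ∀ i' d → P i' + p ≡ P (i' + d) → P (suc i') + p ≡ P (suc i' + d) → P (suc (i' + d)) ≤ x → νu i' ≡ νu (i' + d)
        unit-shift⇒ν≡ i' d e1 e2 le = U-injective i' (i' + d) (≤-trans (P-mono (+-monoʳ-≤ 1 (m≤m+n i' d))) le) le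
           (+-cancelˡ-≡ (P i' + p) _ _ (trans (trans (+-assoc (P i') p (U i')) (trans (cong (P i' +_) (+-comm p (U i'))) (sym (+-assoc (P i') (U i') p)))) (trans e2 (cong (_+ U (i' + d)) (sym e1)))))

        bp≥b : b ≤ b * p
        bp≥b = subst (_≤ b * p) (*-identityʳ b) (*-monoʳ-≤ b p≥1)

        module InsideRun (j o : ℕ) (xeq : x ≡ P (suc j) + o) (o≥1 : 1 ≤ o) (o<b : o < b) where
          i : ℕ
          i = suc j
          Pi≥ : suc s ≤ P i
          Pi≥ = +-cancelʳ-≤ o (suc s) (P i) (subst (suc s + o ≤_) (trans sx xeq) (subst (_≤ s + b * p) (+-suc s o) (+-monoʳ-≤ s (≤-trans o<b bp≥b))))
          Pix : P i < x
          Pix = subst (P i <_) (sym xeq) (subst (_< P i + o) (+-identityʳ (P i)) (+-monoʳ-< (P i) o≥1))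
          o<p : o < p
          o<p with o <? p
          ... | yes l = l
          ... | no nl = ⊥-elim (ney₀ (IsM-unshift y₀ (m≤m+n s w) y₀px ey₀p))
            where
              w : ℕ
              w = proj₁ (≤⇒≡+ Pi≥)
              y₀ : ℕ
              y₀ = s + w
              Pieq : P i ≡ suc y₀
              Pieq = proj₂ (≤⇒≡+ Pi≥)
              p' : ℕ
              p' = proj₁ (≤⇒≡+ p≥1)
              peq : p ≡ suc p'
              peq = proj₂ (≤⇒≡+ p≥1)
              p'<o : p' < o
              p'<o = subst (λ z → z ≤ o) peq (≮⇒≥ nl)
              yeq : y₀ + p ≡ P i + p'
              yeq = trans (cong (y₀ +_) peq) (trans (+-suc y₀ p') (cong (_+ p') (sym Pieq)))
              y₀px : y₀ + p < x
              y₀px = subst (_< x) (sym yeq) (subst (P i + p' <_) (sym xeq) (+-monoʳ-< (P i) p'<o))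
              ey₀p : IsM (y₀ + p)
              ey₀p = subst IsM (sym yeq) (run-IsM i p' (subst (_< x) yeq y₀px) (<-trans p'<o o<b))
              ney₀ : ¬ IsM y₀
              ney₀ = before-unit-¬IsM j y₀ (sym Pieq) (<⇒≤ (subst (_< x) Pieq Pix))
          mp≥p : p ≤ m * p
          mp≥p = subst (_≤ m * p) (*-identityˡ p) (*-monoˡ-≤ p m≥1)
          Pi≥2 : suc (s + p) ≤ P i
          Pi≥2 = +-cancelʳ-≤ o (suc (s + p)) (P i) (subst (suc (s + p) + o ≤_) (trans sx xeq)
                   (subst (_≤ s + b * p) (trans (sym (+-assoc s p (suc o))) (+-suc (s + p) o)) (+-monoʳ-≤ s (+-monoʳ-≤ p (≤-trans o<p mp≥p)))))
          w₂ : ℕ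
          w₂ = proj₁ (≤⇒≡+ Pi≥2)
          Q' : ℕ
          Q' = s + w₂
          Qeq : suc (Q' + p) ≡ P i
          Qeq = trans (sym (suc[x+y]+z≡suc[x+z+y] s p w₂)) (sym (proj₂ (≤⇒≡+ Pi≥2)))
          Q'px : Q' + p < x
          Q'px = <-trans (n<1+n _) (subst (_< x) (sym Qeq) Pix)
          nEQ : ¬ IsM Q'
          nEQ eQ = before-unit-¬IsM j (Q' + p) Qeq (subst (_≤ x) (sym Qeq) (<⇒≤ Pix)) (IsM-shift Q' (m≤m+n s w₂) Q'px eQ)
          ePi : IsM (P i)
          ePi = subst IsM (+-identityʳ (P i)) (run-IsM i 0 (subst (_< x) (sym (+-identityʳ (P i))) Pix) (s≤s z≤n))
          eSQ : IsM (suc Q')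
          eSQ = IsM-unshift (suc Q') (≤-trans (m≤m+n s w₂) (n≤1+n Q')) (subst (_< x) (sym Qeq) Pix) (subst IsM (sym Qeq) ePi)
          us₁ : Σ ℕ λ j → suc Q' ≡ P j
          us₁ = rise⇒unit-start Q' (≤-<-trans (m≤m+n (suc Q') p) (subst (_< x) (sym Qeq) Pix)) eSQ nEQ
          i₁ : ℕ
          i₁ = proj₁ us₁
          Pi₁p : P i₁ + p ≡ P i
          Pi₁p = trans (cong (_+ p) (sym (proj₂ us₁))) Qeq
          i₁<i : i₁ < i
          i₁<i = P-reflects-< (subst (P i₁ <_) Pi₁p (subst (_< P i₁ + p) (+-identityʳ (P i₁)) (+-monoʳ-< (P i₁) p≥1)))
          d' : ℕ
          d' = proj₁ (≤⇒≡+ i₁<i)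
          d : ℕ
          d = suc d'
          ieq : i₁ + d ≡ i
          ieq = trans (+-suc i₁ d') (sym (proj₂ (≤⇒≡+ i₁<i)))
          smp : s + m * p ≡ P i₁ + o
          smp = +-cancelʳ-≡ p _ _ (trans (sym (x+[y+zy]≡x+zy+y s p m)) (trans sx (trans xeq (trans (cong (_+ o) (sym Pi₁p)) (trans (+-assoc (P i₁) p o) (trans (cong (P i₁ +_) (+-comm p o)) (sym (+-assoc (P i₁) o p))))))))
          smpx : s + m * p < x
          smpx = subst (_< x) (+-identityʳ _) (subst (s + m * p + 0 <_) (trans (sym (x+[y+zy]≡x+zy+y s p m)) sx) (+-monoʳ-< (s + m * p) p≥1))
          Es : IsM s
          Es = trans (a-shift-periods m s ≤-refl smpx) (subst IsM (sym smp) (run-IsM i₁ o (subst (_< x) smp smpx) o<b))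
          run₀ : Σ ℕ λ j → Σ ℕ λ o → s ≡ P j + o × o < b
          run₀ = IsM⇒run s (≤-<-trans (m≤m+n s _) smpx) Es
          i₀ : ℕ
          i₀ = proj₁ run₀
          o₀ : ℕ
          o₀ = proj₁ (proj₂ run₀)
          seq : s ≡ P i₀ + o₀
          seq = proj₁ (proj₂ (proj₂ run₀))
          o₀<b : o₀ < b
          o₀<b = proj₂ (proj₂ (proj₂ run₀))
          hs : ∀ i' → i₀ ≤ i' → s ≤ P i' + m
          hs i' le = subst (_≤ P i' + m) (sym seq) (+-mono-≤ (P-mono le) (≤-pred o₀<b))
          chain : ∀ i' → i₀ ≤ i' → i' ≤ i₁ → P i' + p ≡ P (i' + d)
          chain = unit-shift-chain i₀ i₁ d hs (subst (_< x) (sym Pi₁p) Pix) (trans Pi₁p (cong P (sym ieq)))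
          key : P i₁ + o < P (suc i₁)
          key = +-monoʳ-< (P i₁) (<-≤-trans o<b (b≤U i₁))
          Pi₀≤s : P i₀ ≤ s
          Pi₀≤s = subst (P i₀ ≤_) (sym seq) (m≤m+n _ _)
          bnd : ∀ j' → j' ≤ m → P i₀ + j' * p < P (suc i₁)
          bnd j' le = ≤-<-trans (+-mono-≤ Pi₀≤s (*-monoˡ-≤ p le)) (subst (_< P (suc i₁)) (sym smp) key)
          fwd : ∀ j' → j' ≤ m → (i₀ + j' * d ≤ i₁) × (P (i₀ + j' * d) ≡ P i₀ + j' * p)
          fwd zero le = ≤-pred (P-reflects-< (subst (_< P (suc i₁)) (cong P (sym (+-identityʳ i₀))) (≤-<-trans (≤-reflexive (sym (+-identityʳ (P i₀)))) (bnd 0 z≤n)))) , trans (cong P (+-identityʳ i₀)) (sym (+-identityʳ (P i₀)))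
          fwd (suc j') le = ≤-pred (P-reflects-< (subst (_< P (suc i₁)) (sym e) (bnd (suc j') le))) , e
            where
              ih : (i₀ + j' * d ≤ i₁) × (P (i₀ + j' * d) ≡ P i₀ + j' * p)
              ih = fwd j' (≤-trans (n≤1+n j') le)
              e : P (i₀ + suc j' * d) ≡ P i₀ + suc j' * p
              e = trans (cong P (x+[y+zy]≡x+zy+y i₀ d j')) (trans (sym (chain (i₀ + j' * d) (m≤m+n i₀ _) (proj₁ ih)))
                    (trans (cong (_+ p) (proj₂ ih)) (x+yz+z≡x+[z+yz] (P i₀) j' p)))
          i₁≡ : i₁ ≡ i₀ + m * d
          i₁≡ = ≤-antisym (≤-pred (P-reflects-< lt)) (proj₁ (fwd m ≤-refl))
            where
              lt : P i₁ < P (suc (i₀ + m * d))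
              lt = begin-strict
                P i₁ ≤⟨ m≤m+n (P i₁) o ⟩
                P i₁ + o ≡⟨ sym smp ⟩
                s + m * p ≡⟨ cong (_+ m * p) seq ⟩
                P i₀ + o₀ + m * p <⟨ +-monoˡ-< (m * p) (+-monoʳ-< (P i₀) o₀<b) ⟩
                P i₀ + b + m * p ≡⟨ trans (+-assoc (P i₀) b (m * p)) (trans (cong (P i₀ +_) (+-comm b (m * p))) (sym (+-assoc (P i₀) (m * p) b))) ⟩
                P i₀ + m * p + b ≡⟨ cong (_+ b) (sym (proj₂ (fwd m ≤-refl))) ⟩
                P (i₀ + m * d) + b ≤⟨ +-monoʳ-≤ (P (i₀ + m * d)) (b≤U _) ⟩
                P (suc (i₀ + m * d)) ∎
                where open ≤-Reasoning
          h : ∀ j' → j' < m * d → ν (suc i₀ + j') ≡ ν (suc i₀ + j' + d)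
          h j' lt = unit-shift⇒ν≡ (i₀ + j') d (chain (i₀ + j') (m≤m+n i₀ j') (≤-trans (n≤1+n _) sle))
                      (chain (suc (i₀ + j')) (≤-trans (m≤m+n i₀ j') (n≤1+n _)) sle) Pl
            where
              sle : suc (i₀ + j') ≤ i₁
              sle = subst (suc (i₀ + j') ≤_) (sym i₁≡) (subst (_≤ i₀ + m * d) (+-suc i₀ j') (+-monoʳ-≤ i₀ lt))
              Pl : P (suc (i₀ + j' + d)) ≤ x
              Pl = ≤-trans (P-mono (subst (suc (i₀ + j' + d) ≤_) ieq (+-monoˡ-≤ d sle))) (<⇒≤ Pix)
          absurd : ⊥
          absurd = ¬ν-shift-periodic (suc i₀) d (s≤s z≤n) (s≤s z≤n) h

        ¬tail-inside-run : ∀ i o → x ≡ P i + o → 1 ≤ o → o < b → ⊥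
        ¬tail-inside-run zero o xeq o≥1 o<b = <-irrefl refl (<-≤-trans o<b (≤-trans bp≥b (≤-trans (m≤n+m _ s) (≤-reflexive (trans sx xeq)))))
        ¬tail-inside-run (suc j) o xeq o≥1 o<b = InsideRun.absurd j o xeq o≥1 o<b
        glue-agree : ∀ j j' k → νu j ≤ νu j' → k < Γ (suc (νu j)) → P j + b + k < x → P j' + b + k < x → a (P j + b + k) ≡ a (P j' + b + k)
        glue-agree j j' k le gl l1 l2 with glue-piece (νu j) k gl
        ... | (u , uν , k' , refl , kl) =
          trans (proj₂ (IH _ l1) j u k' (sym (+-assoc (P j + b) (Γ u) k')) uν kl)
                (sym (proj₂ (IH _ l2) j' u k' (sym (+-assoc (P j' + b) (Γ u) k')) (≤-trans uν le) kl))

        x≡glue-end : ∀ I → x ≡ P (suc I) → x ≡ P I + b + Γ (suc (νu I))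
        x≡glue-end I xeq = trans xeq (sym (+-assoc (P I) b _))

        module TailInsideGlue (I : ℕ) (xeq : x ≡ P (suc I)) (nsle : ¬ s ≤ P I + m) where
          g : ℕ
          g = Γ (suc (νu I))
          v : ℕ
          v = νu I
          sb : P I + b ≤ s
          sb = subst (_≤ s) (sym (+-suc (P I) m)) (≰⇒> nsle)
          w : ℕ
          w = proj₁ (≤⇒≡+ sb)
          seqw : s ≡ P I + b + w
          seqw = proj₂ (≤⇒≡+ sb)
          wbg : w + b * p ≡ g
          wbg = +-cancelˡ-≡ (P I + b) _ _ (trans (sym (+-assoc (P I + b) w (b * p))) (trans (cong (_+ b * p) (sym seqw)) (trans sx (x≡glue-end I xeq))))
          q : ℕ
          q = proj₁ (b^n≡suc v)
          eqq : b ^ v ≡ suc q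
          eqq = proj₂ (b^n≡suc v)
          νq : νu q ≡ v
          νq = νu-pow v q eqq
          q≤I : q ≤ I
          q≤I = ≤-pred (∣⇒≤⁺ (subst (_∣ suc I) eqq (ν-dvd (suc I) (s≤s z≤n))) (s≤s z≤n))
          PsIx : P (suc I) ≤ x
          PsIx = ≤-reflexive (sym xeq)
          Psqx : P (suc q) ≤ x
          Psqx = ≤-trans (P-mono (s≤s q≤I)) PsIx
          Pq' : P (suc q) ≡ P q + b + g
          Pq' = trans (cong (λ z → P q + (b + Γ (suc z))) νq) (sym (+-assoc (P q) b g))
          s' : ℕ
          s' = P q + b + w
          s'eq : s' + b * p ≡ P (suc q)
          s'eq = trans (+-assoc (P q + b) w (b * p)) (trans (cong (P q + b +_) wbg) (sym Pq'))
          per' : Periodic s' (P (suc q)) p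
          per' y le yp with ≤⇒≡+ le
          ... | (t , refl) = begin
              a (s' + t) ≡⟨ cong a (+-assoc (P q + b) w t) ⟩
              a (P q + b + k) ≡⟨ glue-agree q I k (≤-reflexive νq) kg (<-≤-trans kx1 Psqx) kx2 ⟩
              a (P I + b + k) ≡⟨ per (P I + b + k) (subst (_≤ P I + b + k) (sym seqw) (+-monoʳ-≤ (P I + b) (m≤m+n w t))) kpx ⟩
              a (P I + b + k + p) ≡⟨ cong a (+-assoc (P I + b) k p) ⟩
              a (P I + b + (k + p)) ≡⟨ sym (glue-agree q I (k + p) (≤-reflexive νq) kpg (<-≤-trans kpx1 Psqx) (subst (_< x) (+-assoc (P I + b) k p) kpx)) ⟩
              a (P q + b + (k + p)) ≡⟨ cong a (trans (sym (+-assoc (P q + b) k p)) (cong (_+ p) (sym (+-assoc (P q + b) w t)))) ⟩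
              a (s' + t + p) ∎
            where
              open ≡-Reasoning
              k : ℕ
              k = w + t
              kpg' : P q + b + (k + p) < P q + b + g
              kpg' = subst (_< P q + b + g) (trans (cong (_+ p) (+-assoc (P q + b) w t)) (+-assoc (P q + b) k p)) (subst (s' + t + p <_) Pq' yp)
              kpg : k + p < Γ (suc (νu q))
              kpg = subst (λ z → k + p < Γ (suc z)) (sym νq) (+-cancelˡ-< (P q + b) (k + p) g kpg')
              kg : k < Γ (suc (νu q))
              kg = ≤-<-trans (m≤m+n k p) kpg
              kpx1 : P q + b + (k + p) < P (suc q)
              kpx1 = subst (P q + b + (k + p) <_) (sym Pq') kpg'
              kx1 : P q + b + k < P (suc q)
              kx1 = ≤-<-trans (+-monoʳ-≤ (P q + b) (m≤m+n k p)) kpx1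
              kpx : P I + b + k + p < x
              kpx = subst (_< x) (sym (+-assoc (P I + b) k p)) (subst (P I + b + (k + p) <_) (sym (x≡glue-end I xeq)) (+-monoʳ-< (P I + b) (subst (λ z → k + p < Γ (suc z)) νq kpg)))
              kx2 : P I + b + k < x
              kx2 = ≤-<-trans (m≤m+n _ p) kpx
          cb : b ≤ C (pre (P (suc q)))
          cb = periods≤C (P (suc q)) s' p b p≥1 s'eq per'
          Psq≥1 : 1 ≤ P (suc q)
          Psq≥1 = ≤-trans (s≤s z≤n) (≤-trans (m≤m+n b _) (≤-trans (m≤n+m _ (P q)) ≤-refl))
          aPsq : a (P (suc q)) ≡ m
          aPsq = trans (cong a (trans (cong P (sym eqq)) (lam-suc v))) (proj₂ (proj₂ (gv v (s≤s (νu-bound I PsIx)))))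
          absurd : ⊥
          absurd = <⇒≱ (n<1+n m) (≤-trans cb (a≡m⇒C≤m (P (suc q)) Psq≥1 aPsq))

        ¬tail-short-glue : ∀ I → x ≡ P (suc I) → p ≤ Γ (suc (νu I)) → ⊥
        ¬tail-short-glue I xeq pg with s ≤? P I + m
        ... | yes sle = glue-¬IsM I p' (subst (_< x) e2 ypx) p'<g (subst IsM e2 (IsM-shift y sle ypx ey))
          where
            g : ℕ
            g = Γ (suc (νu I))
            y : ℕ
            y = P I + m
            p' : ℕ
            p' = proj₁ (≤⇒≡+ p≥1)
            peq : p ≡ suc p'
            peq = proj₂ (≤⇒≡+ p≥1)
            p'<g : p' < g
            p'<g = subst (_≤ g) peq pg
            e2 : y + p ≡ P I + b + p'
            e2 = trans (cong (y +_) peq) (trans (+-suc y p') (cong (_+ p') (sym (+-suc (P I) m))))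
            ypx : y + p < x
            ypx = subst (_< x) (sym e2) (subst (P I + b + p' <_) (sym (x≡glue-end I xeq)) (+-monoʳ-< (P I + b) p'<g))
            ey : IsM y
            ey = run-IsM I m (≤-<-trans (m≤m+n y p) ypx) (n<1+n m)
        ... | no nsle = TailInsideGlue.absurd I xeq nsle
        unit-shift-iterate : ∀ i₀ i₁ d → (∀ i' → i₀ ≤ i' → i' ≤ i₁ → P i' + p ≡ P (i' + d)) → P (suc i₁) ≡ P i₀ + m * p → i₀ + m * d ≡ suc i₁
        unit-shift-iterate i₀ i₁ d chain eqm = P-inj (trans (fwd m ≤-refl) (sym eqm))
          where
            fwd : ∀ j → j ≤ m → P (i₀ + j * d) ≡ P i₀ + j * p
            fwd zero le = trans (cong P (+-identityʳ i₀)) (sym (+-identityʳ (P i₀)))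
            fwd (suc j) le = trans (cong P (x+[y+zy]≡x+zy+y i₀ d j)) (trans (sym (chain (i₀ + j * d) (m≤m+n i₀ _) jle))
                               (trans (cong (_+ p) ih) (x+yz+z≡x+[z+yz] (P i₀) j p)))
              where
                ih : P (i₀ + j * d) ≡ P i₀ + j * p
                ih = fwd j (≤-trans (n≤1+n j) le)
                lt1 : P i₀ + j * p < P i₀ + m * p
                lt1 = +-monoʳ-< (P i₀) (<-≤-trans (subst (_< p + j * p) (+-identityˡ (j * p)) (+-monoˡ-< (j * p) p≥1)) (*-monoˡ-≤ p le))
                jle : i₀ + j * d ≤ i₁
                jle = ≤-pred (P-reflects-< (subst (_< P (suc i₁)) (sym ih) (subst (P i₀ + j * p <_) (sym eqm) lt1)))

module NoPeriodicTail (C : List ℕ → ℕ) (hC : ∀ U → U ≢ [] → IsCurling U (C U)) (m : ℕ) (m≥1 : 1 ≤ m) (ℓ : ℕ → ℕ) where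
  open CurlingFacts C hC m m≥1 hiding (b)
  open LayoutFacts C hC m m≥1
  open Layout ℓ
  open Units m m≥1 ℓ

  module PeriodicTailCases (N : ℕ) (gv : ValidGlues (suc N)) (x : ℕ) (xb : x < b * lam (suc N)) (IH : ∀ y → y < x → Model y)
            (s p : ℕ) (p≥1 : 1 ≤ p) (sx : s + b * p ≡ x) (per : Periodic s x p) where
    open StepContext N gv x xb IH
    open PeriodicTail s p p≥1 sx per

    period-start-unit : ∀ I → x ≡ P (suc I) → Γ (suc (νu I)) < p → Σ ℕ λ i₁ → (P i₁ + p ≡ P I) × (s < P i₁ + b)
    period-start-unit I xeq g<p = from-glue-start (fall⇒glue-start Z' (≤-<-trans (m≤m+n _ p) (subst (_< x) (sym Zeq) PIbx)) neZ eZ)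
      where
        g : ℕ
        g = Γ (suc (νu I))
        xeq' : x ≡ P I + b + g
        xeq' = x≡glue-end I xeq
        mp≥p : p ≤ m * p
        mp≥p = subst (_≤ m * p) (*-identityˡ p) (*-monoˡ-≤ p m≥1)
        Bineq : suc (s + p) ≤ P I + b
        Bineq = +-cancelʳ-≤ g (suc (s + p)) (P I + b) (subst (suc (s + p) + g ≤_) (trans sx xeq')
                   (subst (_≤ s + b * p) (trans (sym (+-assoc s p (suc g))) (+-suc (s + p) g)) (+-monoʳ-≤ s (+-monoʳ-≤ p (≤-trans g<p mp≥p)))))
        w : ℕ
        w = proj₁ (≤⇒≡+ Bineq)
        Z' : ℕ
        Z' = s + w
        Zeq : suc (Z' + p) ≡ P I + b
        Zeq = trans (sym (suc[x+y]+z≡suc[x+z+y] s p w)) (sym (proj₂ (≤⇒≡+ Bineq)))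
        PIbx : P I + b < x
        PIbx = subst (P I + b <_) (sym xeq') (subst (_< P I + b + g) (+-identityʳ (P I + b)) (+-monoʳ-< (P I + b) (Γs≥1 (νu I))))
        ZPIm : Z' + p ≡ P I + m
        ZPIm = suc-injective (trans Zeq (+-suc (P I) m))
        Zpx : Z' + p < x
        Zpx = <-trans (n<1+n _) (subst (_< x) (sym Zeq) PIbx)
        eZ : IsM Z'
        eZ = IsM-unshift Z' (m≤m+n s w) Zpx (subst IsM (sym ZPIm) (run-IsM I m (subst (_< x) ZPIm Zpx) (n<1+n m)))
        neZ : ¬ IsM (suc Z')
        neZ ee = glue-¬IsM I 0 (subst (_< x) (sym (+-identityʳ _)) PIbx) (Γs≥1 (νu I)) (subst IsM (trans Zeq (sym (+-identityʳ _))) (IsM-shift (suc Z') (≤-trans (m≤m+n s w) (n≤1+n _)) (subst (_< x) (sym Zeq) PIbx) ee))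
        from-glue-start : Σ ℕ (λ j → suc Z' ≡ P j + b) → Σ ℕ λ i₁ → (P i₁ + p ≡ P I) × (s < P i₁ + b)
        from-glue-start (i₁ , e) = i₁ , +-cancelʳ-≡ b _ _ (trans (trans (+-assoc (P i₁) p b) (trans (cong (P i₁ +_) (+-comm p b)) (sym (+-assoc (P i₁) b p)))) (trans (cong (_+ p) (sym e)) Zeq))
                          , subst (s <_) e (s≤s (m≤m+n s w))

    -- The period carries unit i₁ to unit I; compare the glue g of unit I with the glue g₁ of unit i₁.
    module ShiftedUnit (I : ℕ) (xeq : x ≡ P (suc I)) (g<p : Γ (suc (νu I)) < p) (i₁ : ℕ) (Pi₁p : P i₁ + p ≡ P I) (sPb : s < P i₁ + b) (d' : ℕ) (Ieq0 : I ≡ suc i₁ + d') where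
      d : ℕ
      d = suc d'
      Ieq : i₁ + d ≡ I
      Ieq = trans (+-suc i₁ d') (sym Ieq0)
      i₁<I : i₁ < I
      i₁<I = subst (suc i₁ ≤_) (sym Ieq0) (m≤m+n (suc i₁) d')
      g : ℕ
      g = Γ (suc (νu I))
      xeq' : x ≡ P I + b + g
      xeq' = x≡glue-end I xeq
      PIsx : P (suc I) ≤ x
      PIsx = ≤-reflexive (sym xeq)
      PIbx : P I + b < x
      PIbx = subst (P I + b <_) (sym xeq') (subst (_< P I + b + g) (+-identityʳ (P I + b)) (+-monoʳ-< (P I + b) (Γs≥1 (νu I))))
      smp : s + m * p ≡ P i₁ + b + g
      smp = +-cancelʳ-≡ p _ _ (trans (sym (x+[y+zy]≡x+zy+y s p m)) (trans sx (trans xeq' (trans (cong (λ z → z + b + g) (sym Pi₁p)) (x+y+z+w≡x+z+w+y (P i₁) p b g)))))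
      g₁ : ℕ
      g₁ = Γ (suc (νu i₁))
      Psi₁ : P (suc i₁) ≡ P i₁ + b + g₁
      Psi₁ = sym (+-assoc (P i₁) b g₁)
      PIx : P I < x
      PIx = ≤-<-trans (m≤m+n (P I) b) PIbx
      Psi₁x : P (suc i₁) < x
      Psi₁x = ≤-<-trans (P-mono i₁<I) PIx
      Pi₁px : P i₁ + p < x
      Pi₁px = subst (_< x) (sym Pi₁p) PIx
      sPsi₁ : s ≤ P (suc i₁)
      sPsi₁ = ≤-trans {s} {P i₁ + b} {P (suc i₁)} (<⇒≤ sPb) (+-monoʳ-≤ (P i₁) (b≤U i₁))
      ePsi₁ : IsM (P (suc i₁))
      ePsi₁ = subst IsM (+-identityʳ (P (suc i₁))) (run-IsM (suc i₁) 0 (subst (_< x) (sym (+-identityʳ (P (suc i₁)))) Psi₁x) (s≤s z≤n))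
      Psi₁p : P (suc i₁) + p ≡ P I + b + g₁
      Psi₁p = trans (cong (_+ p) Psi₁) (trans (sym (x+y+z+w≡x+z+w+y (P i₁) p b g₁)) (cong (λ z → z + b + g₁) Pi₁p))
      g≤g₁ : g ≤ g₁
      g≤g₁ with g ≤? g₁
      ... | yes l = l
      ... | no nl = ⊥-elim (glue-¬IsM I g₁ lt (≰⇒> nl) (subst IsM Psi₁p (IsM-shift (P (suc i₁)) sPsi₁ (subst (_< x) (sym Psi₁p) lt) ePsi₁)))
        where
          lt : P I + b + g₁ < x
          lt = subst (P I + b + g₁ <_) (sym xeq') (+-monoʳ-< (P I + b) (≰⇒> nl))
      chainBase : P i₁ + p ≡ P (i₁ + d)
      chainBase = trans Pi₁p (cong P (sym Ieq))

      o₀≡0 : ∀ k o₀ → s ≡ P k + o₀ → o₀ < b → s + m * p ≡ P (suc i₁) → o₀ ≡ 0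
      o₀≡0 k zero seq' ob smpA = refl
      o₀≡0 k (suc o') seq' ob smpA = ⊥-elim (glue-¬IsM k 0 (subst (_< x) (sym (+-identityʳ (P k + b))) Pkbx) (Γs≥1 (νu k)) (subst IsM (sym (+-identityʳ (P k + b))) eE))
        where
          Pssi₁x : P (suc (suc i₁)) ≤ x
          Pssi₁x = ≤-trans (P-mono (s≤s i₁<I)) PIsx
          t' : ℕ
          t' = proj₁ (≤⇒≡+ ob)
          beq : b ≡ suc (suc o') + t'
          beq = proj₂ (≤⇒≡+ ob)
          t : ℕ
          t = suc t'
          st : s + t ≡ P k + b
          st = trans (cong (_+ t) seq') (trans (+-assoc (P k) (suc o') t) (cong (P k +_) (trans (+-suc (suc o') t') (sym beq))))
          t<b : t < b
          t<b = subst (suc t ≤_) (sym beq) (s≤s (s≤s (m≤n+m t' o')))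
          Ptx : P (suc i₁) + t < x
          Ptx = <-≤-trans (+-monoʳ-< (P (suc i₁)) t<b) (≤-trans (+-monoʳ-≤ (P (suc i₁)) (b≤U (suc i₁))) Pssi₁x)
          eqpos : s + t + m * p ≡ P (suc i₁) + t
          eqpos = trans (xy∙z≈xz∙y s t (m * p)) (cong (_+ t) smpA)
          eE : IsM (P k + b)
          eE = subst IsM st (trans (a-shift-periods m (s + t) (m≤m+n s t) (subst (_< x) (sym eqpos) Ptx)) (subst IsM (sym eqpos) (run-IsM (suc i₁) t Ptx t<b)))
          Pkbx : P k + b < x
          Pkbx = subst (_< x) st (≤-<-trans (m≤m+n (s + t) _) (subst (_< x) (sym eqpos) Ptx))

      module EqualGlue (gg : g ≡ g₁) (k : ℕ) (seqk : s ≡ P k) where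
        smpA : s + m * p ≡ P (suc i₁)
        smpA = trans smp (trans (cong (P i₁ + b +_) gg) (sym Psi₁))
        hs : ∀ i' → k ≤ i' → s ≤ P i' + m
        hs i' le = subst (_≤ P i' + m) (sym seqk) (≤-trans (P-mono le) (m≤m+n _ m))
        chainA : ∀ i' → k ≤ i' → i' ≤ i₁ → P i' + p ≡ P (i' + d)
        chainA = unit-shift-chain k i₁ d hs Pi₁px chainBase
        eqm : P (suc i₁) ≡ P k + m * p
        eqm = trans (sym smpA) (cong (_+ m * p) seqk)
        kmd : k + m * d ≡ suc i₁
        kmd = unit-shift-iterate k i₁ d chainA eqm
        ext : P (suc i₁) + p ≡ P (suc i₁ + d)
        ext = trans Psi₁p (trans (cong (P I + b +_) (sym gg)) (trans (sym xeq') (trans xeq (cong (λ z → P (suc z)) (sym Ieq)))))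
        chain' : ∀ i' → k ≤ i' → i' ≤ suc i₁ → P i' + p ≡ P (i' + d)
        chain' i' le1 le2 with i' ≤? i₁
        ... | yes l = chainA i' le1 l
        ... | no nl = subst (λ z → P z + p ≡ P (z + d)) (sym (≤-antisym le2 (≰⇒> nl))) ext
        h : ∀ j → j < m * d → ν (suc k + j) ≡ ν (suc k + j + d)
        h j lt = unit-shift⇒ν≡ (k + j) d (chain' (k + j) (m≤m+n k j) (≤-trans (n≤1+n _) sle))
                   (chain' (suc (k + j)) (≤-trans (m≤m+n k j) (n≤1+n _)) sle) Pl
          where
            sle : suc (k + j) ≤ suc i₁
            sle = subst (suc (k + j) ≤_) kmd (subst (_≤ k + m * d) (+-suc k j) (+-monoʳ-≤ k lt))
            Pl : P (suc (k + j + d)) ≤ x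
            Pl = ≤-trans (P-mono (s≤s (subst (k + j + d ≤_) Ieq (+-monoˡ-≤ d (≤-pred sle))))) PIsx
        absurd : ⊥
        absurd = ¬ν-shift-periodic (suc k) d (s≤s z≤n) (s≤s z≤n) h

      ¬equal-glue : g ≡ g₁ → ⊥
      ¬equal-glue gg = from-run (IsM⇒run s (≤-<-trans (m≤m+n s _) smpx) Es)
        where
          smpA : s + m * p ≡ P (suc i₁)
          smpA = trans smp (trans (cong (P i₁ + b +_) gg) (sym Psi₁))
          smpx : s + m * p < x
          smpx = subst (_< x) (sym smpA) Psi₁x
          Es : IsM s
          Es = trans (a-shift-periods m s ≤-refl smpx) (subst IsM (sym smpA) ePsi₁)
          from-run : (Σ ℕ λ j → Σ ℕ λ o → s ≡ P j + o × o < b) → ⊥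
          from-run (k , o₀ , seq , ob) = EqualGlue.absurd gg k (trans seq (trans (cong (P k +_) (o₀≡0 k o₀ seq ob smpA)) (+-identityʳ (P k))))

      module LongerGlue (gl : g < g₁) (k g₀ : ℕ) (seq : s ≡ P k + b + g₀) (g₀< : g₀ < Γ (suc (νu k))) (r₀' : ℕ) (Psk0 : P (suc k) ≡ suc s + r₀') (t₁ : ℕ) (peq : p ≡ suc g + t₁) where
        r₀ : ℕ
        r₀ = suc r₀'
        Pi₁bgx : P i₁ + b + g < x
        Pi₁bgx = <-trans (+-monoʳ-< (P i₁ + b) gl) (subst (_< x) Psi₁ Psi₁x)
        smpx : s + m * p < x
        smpx = subst (_< x) (sym smp) Pi₁bgx
        sx' : s < x
        sx' = ≤-<-trans (m≤m+n s _) smpx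
        Pi₀ : P (suc k) ≡ P k + b + Γ (suc (νu k))
        Pi₀ = sym (+-assoc (P k) b _)
        Psk : P (suc k) ≡ s + r₀
        Psk = trans Psk0 (sym (+-suc s r₀'))
        s<Psk : s < P (suc k)
        s<Psk = subst (s <_) (sym Psk) (subst (_< s + r₀) (+-identityʳ s) (+-monoʳ-< s (s≤s z≤n)))
        kI : k ≤ I
        kI = ≤-pred (P-reflects-< (≤-<-trans (subst (P k ≤_) (sym seq) (≤-trans (m≤m+n (P k) b) (m≤m+n _ g₀))) (subst (s <_) xeq sx')))
        Psk≤x : P (suc k) ≤ x
        Psk≤x = ≤-trans (P-mono (s≤s kI)) PIsx
        hs : ∀ i' → suc k ≤ i' → s ≤ P i' + m
        hs i' le = ≤-trans (<⇒≤ s<Psk) (≤-trans (P-mono le) (m≤m+n _ m))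
        inGk : ∀ t → t < r₀ → ¬ IsM (s + t)
        inGk t tr = subst (λ z → ¬ IsM z) (sym e1) (glue-¬IsM k (g₀ + t) (subst (_< x) e1 stx) lt)
          where
            e1 : s + t ≡ P k + b + (g₀ + t)
            e1 = trans (cong (_+ t) seq) (+-assoc (P k + b) g₀ t)
            lt' : s + t < P (suc k)
            lt' = subst (s + t <_) (sym Psk) (+-monoʳ-< s tr)
            lt : g₀ + t < Γ (suc (νu k))
            lt = +-cancelˡ-< (P k + b) (g₀ + t) _ (subst₂ _<_ e1 Pi₀ lt')
            stx : s + t < x
            stx = <-≤-trans lt' Psk≤x
        pos1 : s + t₁ + m * p ≡ P I + m
        pos1 = trans (xy∙z≈xz∙y s t₁ (m * p)) (trans (cong (_+ t₁) smp) (trans (x+suc[y]+z+w≡x+[suc[z]+w]+y (P i₁) m g t₁) (trans (cong (λ z → P i₁ + z + m) (sym peq)) (cong (_+ m) Pi₁p))))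
        PImx : P I + m < x
        PImx = <-trans (+-monoʳ-< (P I) (n<1+n m)) PIbx
        Et₁ : IsM (s + t₁)
        Et₁ = trans (a-shift-periods m (s + t₁) (m≤m+n s t₁) (subst (_< x) (sym pos1) PImx)) (subst IsM (sym pos1) (run-IsM I m PImx (n<1+n m)))
        r₀≤t₁ : r₀ ≤ t₁
        r₀≤t₁ with r₀ ≤? t₁
        ... | yes l = l
        ... | no nl = ⊥-elim (inGk t₁ (≰⇒> nl) Et₁)
        PskMx : P (suc k) + m * p < x
        PskMx = ≤-<-trans (subst (_≤ s + t₁ + m * p) (cong (_+ m * p) (sym Psk)) (+-monoˡ-≤ (m * p) (+-monoʳ-≤ s r₀≤t₁))) (subst (_< x) (sym pos1) PImx)
        sPsk : s ≤ P (suc k)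
        sPsk = <⇒≤ s<Psk
        ePsk : IsM (P (suc k))
        ePsk = subst IsM (+-identityʳ (P (suc k))) (run-IsM (suc k) 0 (subst (_< x) (sym (+-identityʳ (P (suc k)))) (≤-<-trans (m≤m+n _ (m * p)) PskMx)) (s≤s z≤n))
        ePskM : IsM (P (suc k) + m * p)
        ePskM = trans (sym (a-shift-periods m (P (suc k)) sPsk PskMx)) ePsk
        y₅ : ℕ
        y₅ = s + r₀'
        y₅eq : suc y₅ ≡ P (suc k)
        y₅eq = sym Psk0
        ¬Ey₅ : ¬ IsM y₅
        ¬Ey₅ = before-unit-¬IsM k y₅ y₅eq (subst (_≤ x) (sym y₅eq) Psk≤x)
        y₅Mx : suc (y₅ + m * p) < x
        y₅Mx = subst (_< x) (cong (_+ m * p) (sym y₅eq)) PskMx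
        ¬Ey₅M : ¬ IsM (y₅ + m * p)
        ¬Ey₅M e = ¬Ey₅ (trans (a-shift-periods m y₅ (m≤m+n s r₀') (<-trans (n<1+n _) y₅Mx)) e)
        us : Σ ℕ λ j → suc (y₅ + m * p) ≡ P j
        us = rise⇒unit-start (y₅ + m * p) y₅Mx (subst IsM (cong (_+ m * p) (sym y₅eq)) ePskM) ¬Ey₅M

        module LongerGlueStart (k₂ : ℕ) (k₂eq : suc (y₅ + m * p) ≡ P k₂) where
          Pk₂ : P k₂ ≡ s + m * p + r₀
          Pk₂ = trans (sym k₂eq) (trans (cong (_+ m * p) y₅eq) (trans (cong (_+ m * p) Psk) (xy∙z≈xz∙y s r₀ (m * p))))
          smp<Pk₂ : s + m * p < P k₂
          smp<Pk₂ = subst (s + m * p <_) (sym Pk₂) (subst (_< s + m * p + r₀) (+-identityʳ _) (+-monoʳ-< (s + m * p) (s≤s z≤n)))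
          lower : suc i₁ ≤ k₂
          lower = P-reflects-< (≤-<-trans (subst (P i₁ ≤_) (sym smp) (≤-trans (m≤m+n (P i₁) b) (m≤m+n _ g))) smp<Pk₂)
          smp<Psi₁ : s + m * p < P (suc i₁)
          smp<Psi₁ = subst (_< P (suc i₁)) (sym smp) (subst (P i₁ + b + g <_) (sym Psi₁) (+-monoʳ-< (P i₁ + b) gl))
          upper : k₂ ≤ suc i₁
          upper with k₂ ≤? suc i₁
          ... | yes l = l
          ... | no nl = ⊥-elim (inGk t₂ t₂<r₀ Et₂)
            where
              t₂' : ℕ
              t₂' = proj₁ (≤⇒≡+ smp<Psi₁)
              t₂ : ℕ
              t₂ = suc t₂'
              eq₂ : P (suc i₁) ≡ s + m * p + t₂
              eq₂ = trans (proj₂ (≤⇒≡+ smp<Psi₁)) (sym (+-suc (s + m * p) t₂'))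
              Psi₁<Pk₂ : P (suc i₁) < P k₂
              Psi₁<Pk₂ = <-≤-trans (subst (_< P (suc i₁) + b) (+-identityʳ _) (+-monoʳ-< (P (suc i₁)) (s≤s z≤n))) (P-strict (≰⇒> nl))
              t₂<r₀ : t₂ < r₀
              t₂<r₀ = +-cancelˡ-< (s + m * p) t₂ r₀ (subst₂ _<_ eq₂ Pk₂ Psi₁<Pk₂)
              e3 : s + t₂ + m * p ≡ P (suc i₁)
              e3 = trans (xy∙z≈xz∙y s t₂ (m * p)) (sym eq₂)
              Et₂ : IsM (s + t₂)
              Et₂ = trans (a-shift-periods m (s + t₂) (m≤m+n s t₂) (subst (_< x) (sym e3) Psi₁x)) (subst IsM (sym e3) ePsi₁)
          k₂≡ : k₂ ≡ suc i₁
          k₂≡ = ≤-antisym upper lower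
          eqm : P (suc i₁) ≡ P (suc k) + m * p
          eqm = trans (cong P (sym k₂≡)) (trans (sym k₂eq) (cong (_+ m * p) y₅eq))
          chainU : ∀ i' → suc k ≤ i' → i' ≤ i₁ → P i' + p ≡ P (i' + d)
          chainU = unit-shift-chain (suc k) i₁ d hs Pi₁px chainBase
          kmd : suc k + m * d ≡ suc i₁
          kmd = unit-shift-iterate (suc k) i₁ d chainU eqm
          hU : ∀ j → suc j < m * d → ν (suc (suc k) + j) ≡ ν (suc (suc k) + j + d)
          hU j lt = unit-shift⇒ν≡ (suc k + j) d (chainU (suc k + j) (m≤m+n (suc k) j) (≤-trans (n≤1+n _) sle))
                      (chainU (suc (suc k + j)) (≤-trans (m≤m+n (suc k) j) (n≤1+n _)) sle) Pl
            where
              sle : suc (suc k + j) ≤ i₁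
              sle = ≤-pred (subst (suc (suc (suc k + j)) ≤_) kmd (subst (_≤ suc k + m * d) (trans (+-suc (suc k) (suc j)) (cong suc (+-suc (suc k) j))) (+-monoʳ-≤ (suc k) lt)))
              Pl : P (suc (suc k + j + d)) ≤ x
              Pl = ≤-trans (P-mono (s≤s (subst (suc k + j + d ≤_) Ieq (+-monoˡ-≤ d (≤-trans (n≤1+n _) sle))))) PIsx
          νIi₁ : νu I < νu i₁
          νIi₁ with νu I <? νu i₁
          ... | yes l = l
          ... | no nl = ⊥-elim (<-irrefl refl (<-≤-trans gl (Γ-mono (s≤s (≮⇒≥ nl)))))
          hJ : ν (suc i₁ + d) < ν (suc i₁)
          hJ = subst (_< ν (suc i₁)) (sym (cong νu Ieq)) νIi₁
          nt : (m ≡ 1) × (ν d < ν (suc i₁))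
          nt = ν-shift-periodic⇒m≡1 (suc (suc k)) d (suc i₁) (s≤s z≤n) (s≤s z≤n) (cong suc kmd) hU hJ

          module LongerGlueM1 (m≡1 : m ≡ 1) (νdJ : ν d < ν (suc i₁)) (q : ℕ) (eqq : b ^ νu i₁ ≡ suc q) where
            e' : ℕ
            e' = νu i₁
            md≡d : m * d ≡ d
            md≡d = trans (cong (_* d) m≡1) (*-identityˡ d)
            mp≡p : m * p ≡ p
            mp≡p = trans (cong (_* p) m≡1) (*-identityˡ p)
            kd : suc k + d ≡ suc i₁
            kd = trans (cong (suc k +_) (sym md≡d)) kmd
            νk : νu k ≡ ν d
            νk = ν-+-higher⁻¹ (suc k) d (s≤s z≤n) (s≤s z≤n) (subst (λ z → ν d < ν z) (sym kd) νdJ)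
            νI : νu I ≡ ν d
            νI = trans (cong (λ z → ν (suc z)) (sym Ieq)) (ν-+-higher (suc i₁) d (s≤s z≤n) (s≤s z≤n) νdJ)
            Γk : Γ (suc (νu k)) ≡ g
            Γk = cong (λ z → Γ (suc z)) (trans νk (sym νI))
            g₀r₀ : g₀ + r₀ ≡ g
            g₀r₀ = trans (+-cancelˡ-≡ (P k + b) _ _ (trans (sym (+-assoc (P k + b) g₀ r₀)) (trans (cong (_+ r₀) (sym seq)) (trans (sym Psk) Pi₀)))) Γk
            sp : s + p ≡ P i₁ + b + g
            sp = trans (cong (s +_) (sym mp≡p)) smp
            gr₀ : g + r₀ ≡ g₁
            gr₀ = +-cancelˡ-≡ (P i₁ + b) _ _ (trans (sym (+-assoc (P i₁ + b) g r₀)) (trans (cong (_+ r₀) (sym sp)) (trans (xy∙z≈xz∙y s p r₀) (trans (cong (_+ p) (sym Psk)) (trans (cong (P (suc k) +_) (sym mp≡p)) (trans (sym eqm) Psi₁))))))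
            νq : νu q ≡ e'
            νq = νu-pow e' q eqq
            q≤i₁ : q ≤ i₁
            q≤i₁ = ≤-pred (∣⇒≤⁺ (subst (_∣ suc i₁) eqq (ν-dvd (suc i₁) (s≤s z≤n))) (s≤s z≤n))
            Psq : P (suc q) ≡ P q + b + g₁
            Psq = trans (cong (λ z → P q + (b + Γ (suc z))) νq) (sym (+-assoc (P q) b g₁))
            Psq<x : P (suc q) < x
            Psq<x = ≤-<-trans (P-mono (s≤s q≤i₁)) Psi₁x
            s' : ℕ
            s' = P q + b + g₀
            s'eq : s' + 2 * r₀ ≡ P (suc q)
            s'eq = trans (x+y+2z≡x+[y+z]+z (P q + b) g₀ r₀) (trans (cong (λ z → P q + b + z + r₀) g₀r₀) (trans (+-assoc (P q + b) g r₀) (trans (cong (P q + b +_) gr₀) (sym Psq))))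
            νkq : νu k ≤ νu q
            νkq = <⇒≤ (subst (_< νu q) (sym νk) (subst (ν d <_) (sym νq) νdJ))
            per' : Periodic s' (P (suc q)) r₀
            per' y le yl with ≤⇒≡+ le
            ... | (t , refl) = begin
                a (s' + t) ≡⟨ cong a (+-assoc (P q + b) g₀ t) ⟩
                a (P q + b + (g₀ + t)) ≡⟨ sym (glue-agree k q (g₀ + t) νkq g₀t< (subst (_< x) e1 stx) q1) ⟩
                a (P k + b + (g₀ + t)) ≡⟨ cong a (sym e1) ⟩
                a (s + t) ≡⟨ per (s + t) (m≤m+n s t) stpx ⟩
                a (s + t + p) ≡⟨ cong a e2 ⟩
                a (P i₁ + b + (g + t)) ≡⟨ glue-agree i₁ q (g + t) (≤-reflexive (sym νq)) gt< q2' q2 ⟩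
                a (P q + b + (g + t)) ≡⟨ cong a (sym (shifted-position t)) ⟩
                a (s' + t + r₀) ∎
              where
                open ≡-Reasoning
                t<r₀ : t < r₀
                t<r₀ = +-cancelʳ-< r₀ t r₀ (subst (t + r₀ <_) (cong (r₀ +_) (+-identityʳ r₀)) (+-cancelˡ-< s' _ _ (subst₂ _<_ (+-assoc s' t r₀) (sym s'eq) yl)))
                e1 : s + t ≡ P k + b + (g₀ + t)
                e1 = trans (cong (_+ t) seq) (+-assoc (P k + b) g₀ t)
                g₀t< : g₀ + t < Γ (suc (νu k))
                g₀t< = subst (g₀ + t <_) (sym Γk) (subst (g₀ + t <_) g₀r₀ (+-monoʳ-< g₀ t<r₀))
                stx : s + t < x
                stx = <-≤-trans (subst (s + t <_) (sym Psk) (+-monoʳ-< s t<r₀)) Psk≤x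
                gt< : g + t < Γ (suc (νu i₁))
                gt< = subst (g + t <_) gr₀ (+-monoʳ-< g t<r₀)
                q2 : P q + b + (g + t) < x
                q2 = <-trans (subst (P q + b + (g + t) <_) (sym Psq) (+-monoʳ-< (P q + b) gt<)) Psq<x
                q1 : P q + b + (g₀ + t) < x
                q1 = ≤-<-trans (+-monoʳ-≤ (P q + b) (+-monoˡ-≤ t (subst (g₀ ≤_) g₀r₀ (m≤m+n g₀ r₀)))) q2
                q2' : P i₁ + b + (g + t) < x
                q2' = <-trans (subst (P i₁ + b + (g + t) <_) (sym Psi₁) (+-monoʳ-< (P i₁ + b) gt<)) Psi₁x
                e2 : s + t + p ≡ P i₁ + b + (g + t)
                e2 = trans (xy∙z≈xz∙y s t p) (trans (cong (_+ t) sp) (+-assoc (P i₁ + b) g t))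
                stpx : s + t + p < x
                stpx = subst (_< x) (sym e2) q2'
                shifted-position : ∀ t → s' + t + r₀ ≡ P q + b + (g + t)
                shifted-position t = trans (x+y+z+w≡x+[y+w+z] (P q + b) g₀ t r₀) (cong (λ z → P q + b + (z + t)) g₀r₀)
            cb : 2 ≤ C (pre (P (suc q)))
            cb = periods≤C (P (suc q)) s' r₀ 2 (s≤s z≤n) s'eq per'
            aPsq : a (P (suc q)) ≡ m
            aPsq = trans (cong a (trans (cong P (sym eqq)) (lam-suc e'))) (proj₂ (proj₂ (gv e' (s≤s (νu-bound i₁ (<⇒≤ Psi₁x))))))
            absurd : ⊥
            absurd = 1+n≰n (subst (2 ≤_) m≡1 (≤-trans cb (a≡m⇒C≤m (P (suc q)) (≤-trans (s≤s z≤n) (≤-trans (b≤U q) (m≤n+m _ (P q)))) aPsq)))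

          absurd : ⊥
          absurd = LongerGlueM1.absurd (proj₁ nt) (proj₂ nt) (proj₁ (b^n≡suc (νu i₁))) (proj₂ (b^n≡suc (νu i₁)))

        absurd : ⊥
        absurd = LongerGlueStart.absurd (proj₁ us) (proj₂ us)

      ¬longer-glue : g < g₁ → ⊥
      ¬longer-glue gl = from-glue (¬IsM⇒glue s sx' ¬Es)
        where
          Pi₁bgx : P i₁ + b + g < x
          Pi₁bgx = <-trans (+-monoʳ-< (P i₁ + b) gl) (subst (_< x) Psi₁ Psi₁x)
          smpx : s + m * p < x
          smpx = subst (_< x) (sym smp) Pi₁bgx
          sx' : s < x
          sx' = ≤-<-trans (m≤m+n s _) smpx
          ¬Es : ¬ IsM s
          ¬Es es = glue-¬IsM i₁ g Pi₁bgx gl (subst IsM smp (trans (sym (a-shift-periods m s ≤-refl smpx)) es))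
          from-glue : (Σ ℕ λ j → Σ ℕ λ g' → s ≡ P j + b + g' × g' < Γ (suc (νu j))) → ⊥
          from-glue (k , g₀ , seq , g₀<) = LongerGlue.absurd gl k g₀ seq g₀< (proj₁ (≤⇒≡+ sk)) (proj₂ (≤⇒≡+ sk)) (proj₁ (≤⇒≡+ g<p)) (proj₂ (≤⇒≡+ g<p))
            where
              sk : s < P (suc k)
              sk = subst (_< P (suc k)) (sym seq) (subst (P k + b + g₀ <_) (+-assoc (P k) b _) (+-monoʳ-< (P k + b) g₀<))

      contradiction-at-unit : ⊥
      contradiction-at-unit with g ≟ g₁
      ... | yes e = ¬equal-glue e
      ... | no ne = ¬longer-glue (≤∧≢⇒< g≤g₁ ne)

    ¬tail-at-unit-start : ∀ I → x ≡ P (suc I) → ⊥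
    ¬tail-at-unit-start I xeq with Γ (suc (νu I)) <? p
    ... | no ngp = ¬tail-short-glue I xeq (≮⇒≥ ngp)
    ... | yes gp = from-shifted-unit (period-start-unit I xeq gp)
      where
        from-shifted-unit : (Σ ℕ λ i₁ → (P i₁ + p ≡ P I) × (s < P i₁ + b)) → ⊥
        from-shifted-unit (i₁ , Pi₁p , sPb) = ShiftedUnit.contradiction-at-unit I xeq gp i₁ Pi₁p sPb (proj₁ (≤⇒≡+ i₁<I)) (proj₂ (≤⇒≡+ i₁<I))
          where
            i₁<I : i₁ < I
            i₁<I = P-reflects-< (subst (P i₁ <_) Pi₁p (subst (_< P i₁ + p) (+-identityʳ (P i₁)) (+-monoʳ-< (P i₁) p≥1)))

    ¬periodic-tail : ∀ i o → x ≡ P i + o → o < b → ⊥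
    ¬periodic-tail zero zero xeq _ = <-irrefl refl (<-≤-trans (s≤s z≤n) (≤-trans (≤-trans p≥1 (m≤m+n p (m * p))) (≤-trans (m≤n+m _ s) (≤-reflexive (trans sx xeq)))))
    ¬periodic-tail (suc I) zero xeq _ = ¬tail-at-unit-start I (trans xeq (+-identityʳ _))
    ¬periodic-tail i (suc o) xeq ob = ¬tail-inside-run i (suc o) xeq (s≤s z≤n) ob

module LayoutModel (C : List ℕ → ℕ) (hC : ∀ U → U ≢ [] → IsCurling U (C U)) (m : ℕ) (m≥1 : 1 ≤ m) where
  open CurlingFacts C hC m m≥1 hiding (b)
  open LayoutFacts C hC m m≥1

  C≤length : ∀ k → 1 ≤ k → C (pre k) ≤ k
  C≤length k k≥1 with C-period k k≥1
  ... | (p , s , p≥1 , eq , _) = ≤-trans (subst (_≤ C (pre k) * p) (*-identityʳ _) (*-monoʳ-≤ (C (pre k)) p≥1)) (≤-trans (m≤n+m _ s) (≤-reflexive eq))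

  module ByInduction (ℓ : ℕ → ℕ) where
    open Layout ℓ
    open Units m m≥1 ℓ
    open NoPeriodicTail C hC m m≥1 ℓ

    base : ∀ x → x < b * lam 0 → Model x
    base x xb = run-value , glue-value
      where
        xb' : x < b
        xb' = subst (x <_) (*-identityʳ b) xb
        first-run : ∀ y → y < b → a y ≡ m
        first-run zero _ = refl
        first-run (suc y) lt = C≤m⇒a≡m (suc y) (s≤s z≤n) (≤-trans (C≤length (suc y) (s≤s z≤n)) (≤-pred lt))
        run-value : ∀ i o → x ≡ P i + o → o < b → a x ≡ m
        run-value _ _ _ _ = first-run x xb'
        glue-value : ∀ i u k → x ≡ P i + b + Γ u + k → u ≤ νu i → k < ℓ u → a x ≡ a (b * lam u + k)
        glue-value i u k eq _ _ = ⊥-elim (<-irrefl refl (<-≤-trans xb' (subst (b ≤_) (sym eq) (≤-trans (m≤n+m b (P i)) (≤-trans (m≤m+n _ (Γ u)) (m≤m+n _ k))))))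

    module Step (N : ℕ) (gv : ValidGlues (suc N)) (x : ℕ) (xb : x < b * lam (suc N)) (IH : ∀ y → y < x → Model y) where
      open StepContext N gv x xb IH

      run-value : ∀ i o → x ≡ P i + o → o < b → a x ≡ m
      run-value i o xeq ob with x ≟ 0
      ... | yes x0 = subst (λ z → a z ≡ m) (sym x0) refl
      ... | no nx0 with C (pre x) ≤? m
      ... | yes le = C≤m⇒a≡m x (n≢0⇒n>0 nx0) le
      ... | no nle = from-period (C-period x (n≢0⇒n>0 nx0))
        where
          from-period : (Σ ℕ λ p → Σ ℕ λ s → 1 ≤ p × s + C (pre x) * p ≡ x × Periodic s x p) → a x ≡ m
          from-period (p , s₁ , p≥1 , eq₁ , per₁) = ⊥-elim (PeriodicTailCases.¬periodic-tail N gv x xb IH (s₁ + r' * p) p p≥1 sx per i o xeq ob)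
            where
              r' : ℕ
              r' = proj₁ (≤⇒≡+ (≰⇒> nle))
              req : C (pre x) ≡ b + r'
              req = proj₂ (≤⇒≡+ (≰⇒> nle))
              sx : s₁ + r' * p + b * p ≡ x
              sx = trans (x+yz+wz≡x+[w+y]z s₁ r' p b) (trans (cong (λ z → s₁ + z * p) (sym req)) eq₁)
              per : Periodic (s₁ + r' * p) x p
              per = Periodic-restrict per₁ (m≤m+n s₁ _) ≤-refl

      module GlueCopy (i u k : ℕ) (xeq : x ≡ P i + b + Γ u + k) (uν : u ≤ νu i) (kl : k < ℓ u) (q : ℕ) (eqq : b ^ u ≡ suc q) (t : ℕ) (ieq : i ≡ t + q) (dv : b ^ u ∣ t) where
        uN : u < suc N
        uN with suc i <? b ^ suc N
        ... | yes sj = ≤-<-trans uν (ν-bound (suc i) (suc N) (s≤s z≤n) sj)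
        ... | no nsj with u <? suc N
        ... | yes ok = ok
        ... | no nok = ⊥-elim (<-irrefl refl (<-≤-trans xb' (subst (P qN + b + Γ (suc N) ≤_) (sym xeq) le)))
          where
            qj : qN ≤ i
            qj = ≤-pred (subst (_≤ suc i) eqN (≮⇒≥ nsj))
            le : P qN + b + Γ (suc N) ≤ P i + b + Γ u + k
            le = ≤-trans (+-mono-≤ (+-monoˡ-≤ b (P-mono qj)) (Γ-mono (≮⇒≥ nok))) (m≤m+n _ k)
        c : ℕ
        c = b * lam u + k
        c≥1 : 1 ≤ c
        c≥1 = ≤-trans lam≥1' (m≤m+n _ k)
          where
            lam≥1' : 1 ≤ b * lam u
            lam≥1' = subst (1 ≤_) (sym (b*lam≡ u q eqq)) (≤-trans (s≤s z≤n) (≤-trans (m≤n+m b (P q)) (m≤m+n _ (Γ u))))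
        ceq : c ≡ P q + b + Γ u + k
        ceq = cong (_+ k) (b*lam≡ u q eqq)
        νq : νu q ≡ u
        νq = νu-pow u q eqq
        Psq : P (suc q) ≡ P q + b + Γ u + ℓ u
        Psq = trans (cong (λ z → P q + (b + Γ (suc z))) νq) (x+[y+[z+w]]≡x+y+z+w (P q) b (Γ u) (ℓ u))
        c<Psq : c < P (suc q)
        c<Psq = subst (c <_) (sym Psq) (subst (_< P q + b + Γ u + ℓ u) (sym ceq) (+-monoʳ-< (P q + b + Γ u) kl))
        q<bu : q < b ^ u
        q<bu = subst (q <_) (sym eqq) (n<1+n q)
        xeq2 : x ≡ P t + c
        xeq2 = trans xeq (trans (cong (λ z → z + b + Γ u + k) (trans (cong P ieq) (P-+ u t q dv q<bu))) (trans (sym (x+[y+z+w+v]≡x+y+z+w+v (P t) (P q) b (Γ u) k)) (cong (P t +_) (sym ceq))))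
        cx : c ≤ x
        cx = subst (c ≤_) (sym xeq2) (m≤n+m c (P t))
        copied : ∀ y → y < c → y < x
        copied y yc = <-≤-trans yc cx

        copy : ∀ y → y < c → P t + y < x
        copy y yc = subst (P t + y <_) (sym xeq2) (+-monoʳ-< (P t) yc)

        unit<q : ∀ r y → P r ≤ y → y < c → r ≤ q
        unit<q r y lr yc = ≤-pred (P-reflects-< (≤-<-trans lr (<-trans yc c<Psq)))

        P-shift : ∀ r → r ≤ q → P (t + r) ≡ P t + P r
        P-shift r r≤q = P-+ u t r dv (≤-<-trans r≤q q<bu)

        copy-run : ∀ r o → P r + o < c → o < b → a (P t + (P r + o)) ≡ a (P r + o)
        copy-run r o lt ob =
          trans (proj₁ (IH _ (copy _ lt)) (t + r) o shifted ob) (sym (proj₁ (IH _ (copied _ lt)) r o refl ob))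
          where
            shifted : P t + (P r + o) ≡ P (t + r) + o
            shifted = trans (sym (+-assoc (P t) (P r) o)) (cong (_+ o) (sym (P-shift r (unit<q r _ (m≤m+n (P r) o) lt))))

        glue-start≤ : ∀ r u' k' → P r ≤ P r + b + Γ u' + k'
        glue-start≤ r u' k' = ≤-trans (≤-trans (m≤m+n (P r) b) (m≤m+n _ (Γ u'))) (m≤m+n _ k')

        νu-copy : ∀ r u' k' → P r + b + Γ u' + k' < c → u' ≤ νu r → u' ≤ νu (t + r)
        νu-copy r u' k' lt u'ν with r <? q
        ... | yes r<q = subst (u' ≤_) (sym νu≡) u'ν
          where
            νu≡ : νu (t + r) ≡ νu r
            νu≡ = trans (cong ν (sym (+-suc t r))) (ν-+-multiple t (suc r) u dv (s≤s z≤n) (λ d → <⇒≱ (≤-<-trans r<q q<bu) (∣⇒≤⁺ d (s≤s z≤n))))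
        ... | no nrq = ≤-trans u'≤u (subst (u ≤_) (cong νu (trans ieq (cong (t +_) (sym rq)))) uν)
          where
            rq : r ≡ q
            rq = ≤-antisym (unit<q r _ (glue-start≤ r u' k') lt) (≮⇒≥ nrq)
            lt1 : Γ u' + k' < Γ u + k
            lt1 = +-cancelˡ-< (P q + b) _ _ (subst₂ _<_ (trans (cong (λ w → P w + b + Γ u' + k') rq) (+-assoc (P q + b) (Γ u') k')) (trans ceq (+-assoc (P q + b) (Γ u) k)) lt)
            u'≤u : u' ≤ u
            u'≤u with u' ≤? u
            ... | yes l = l
            ... | no nl = ⊥-elim (<-irrefl refl (<-≤-trans (≤-<-trans (m≤m+n (Γ u') k') lt1) (≤-trans (+-monoʳ-≤ (Γ u) (<⇒≤ kl)) (Γ-mono (≰⇒> nl)))))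

        copy-glue : ∀ r u' k' → P r + b + Γ u' + k' < c → u' ≤ νu r → k' < ℓ u'
                    → a (P t + (P r + b + Γ u' + k')) ≡ a (P r + b + Γ u' + k')
        copy-glue r u' k' lt u'ν k'l =
          trans (proj₂ (IH _ (copy _ lt)) (t + r) u' k' shifted (νu-copy r u' k' lt u'ν) k'l)
                (sym (proj₂ (IH _ (copied _ lt)) r u' k' refl u'ν k'l))
          where
            shifted : P t + (P r + b + Γ u' + k') ≡ P (t + r) + b + Γ u' + k'
            shifted = trans (x+[y+z+w+v]≡x+y+z+w+v (P t) (P r) b (Γ u') k')
                            (cong (λ w → w + b + Γ u' + k') (sym (P-shift r (unit<q r _ (glue-start≤ r u' k') lt))))

        content : ∀ z → z < c → a (P t + z) ≡ a z
        content z zc with run-or-glue z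
        ... | inj₁ (r , o , refl , ob) = copy-run r o zc ob
        ... | inj₂ (r , g , refl , gl) with glue-piece (νu r) g gl
        ... | (u' , u'ν , k' , refl , k'l) =
          subst (λ y → a (P t + y) ≡ a y) (+-assoc (P r + b) (Γ u') k')
                (copy-glue r u' k' (subst (_< c) (sym (+-assoc (P r + b) (Γ u') k')) zc) u'ν k'l)

        value : a x ≡ a (b * lam u + k)
        value with t ≟ 0
        ... | yes t0 = cong a (trans xeq2 (cong (λ z → P z + c) t0))
        ... | no nt0 = trans (cong a xeq2) (a-copy (P t) c c≥1 content (proj₁ (proj₂ (gv u uN)) k kl))

      glue-value : ∀ i u k → x ≡ P i + b + Γ u + k → u ≤ νu i → k < ℓ u → a x ≡ a (b * lam u + k)
      glue-value i u k xeq uν kl = GlueCopy.value i u k xeq uν kl q eqq t (trans ieq0 (+-comm q t)) dv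
        where
          q : ℕ
          q = proj₁ (b^n≡suc u)
          eqq : b ^ u ≡ suc q
          eqq = proj₂ (b^n≡suc u)
          bu∣si : b ^ u ∣ suc i
          bu∣si = ≤ν⇒∣ (suc i) u (s≤s z≤n) uν
          q≤i : q ≤ i
          q≤i = ≤-pred (∣⇒≤⁺ (subst (_∣ suc i) eqq bu∣si) (s≤s z≤n))
          t : ℕ
          t = proj₁ (≤⇒≡+ q≤i)
          ieq0 : i ≡ q + t
          ieq0 = proj₂ (≤⇒≡+ q≤i)
          dv : b ^ u ∣ t
          dv = ∣m+n∣m⇒∣n (subst (b ^ u ∣_) (cong suc ieq0) bu∣si) (subst (b ^ u ∣_) eqq ∣-refl)

      model : Model x
      model = run-value , glue-value

    model-below : ∀ N → ValidGlues N → ∀ x → x < b * lam N → Model x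
    model-below zero _ = base
    model-below (suc N) gv = <-rec (λ x → x < b * lam (suc N) → Model x) step
      where
        step : ∀ x → (∀ {y} → y < x → y < b * lam (suc N) → Model y) → x < b * lam (suc N) → Model x
        step x ih xb = Step.model N gv x xb (λ y yx → ih yx (<-trans yx xb))

module BlockConstruction (C : List ℕ → ℕ) (hC : ∀ U → U ≢ [] → IsCurling U (C U)) (m : ℕ) (m≥1 : 1 ≤ m) where
  open CurlingFacts C hC m m≥1 hiding (b)
  open LayoutFacts C hC m m≥1
  open LayoutModel C hC m m≥1

  module GlueBlocks (ℓ : ℕ → ℕ) where
    open Layout ℓ
    open Units m m≥1 ℓ
    open ByInduction ℓ

    same-offset : ∀ B → (∀ y → y < B → Model y) → ∀ j j' o' → o' < U j → νu j ≤ νu j' → P j + o' < B → P j' + o' < B → a (P j + o') ≡ a (P j' + o')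
    same-offset B mdl j j' o' ou le l1 l2 with o' <? b
    ... | yes ob = trans (proj₁ (mdl _ l1) j o' refl ob) (sym (proj₁ (mdl _ l2) j' o' refl ob))
    ... | no nob with ≤⇒≡+ (≮⇒≥ nob)
    ... | (g' , refl) with glue-piece (νu j) g' (+-cancelˡ-< b g' _ ou)
    ... | (u' , u'ν , k' , refl , k'l) = trans (proj₂ (mdl _ l1) j u' k' e1 u'ν k'l) (sym (proj₂ (mdl _ l2) j' u' k' e2 (≤-trans u'ν le) k'l))
      where
        e1 : P j + (b + (Γ u' + k')) ≡ P j + b + Γ u' + k'
        e1 = trans (sym (+-assoc (P j) b _)) (sym (+-assoc (P j + b) (Γ u') k'))
        e2 : P j' + (b + (Γ u' + k')) ≡ P j' + b + Γ u' + k'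
        e2 = trans (sym (+-assoc (P j') b _)) (sym (+-assoc (P j' + b) (Γ u') k'))

    lam≥1 : ∀ N → 1 ≤ lam N
    lam≥1 zero = ≤-refl
    lam≥1 (suc N) with b^n≡suc N
    ... | (q , eq) = subst (1 ≤_) (cong P (sym eq)) (≤-trans (s≤s z≤n) (≤-trans (b≤U q) (m≤n+m _ (P q))))

    a-lam-periodic : ∀ N → ValidGlues N → ∀ c z → c < b → z < lam N → a (c * lam N + z) ≡ a z
    a-lam-periodic zero gv c zero cb _ = proj₁ (model-below zero gv (c * 1 + 0) (subst (_< b * 1) (sym (trans (+-identityʳ _) (*-identityʳ c))) (subst (c <_) (sym (*-identityʳ b)) cb))) 0 (c * 1 + 0) refl (subst (_< b) (sym (trans (+-identityʳ _) (*-identityʳ c))) cb)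
    a-lam-periodic zero gv c (suc z) cb (s≤s ())
    a-lam-periodic (suc n) gv c z cb zl with unit-containing z
    ... | (r , lr , ur) with ≤⇒≡+ lr
    ... | (o' , refl) = trans (cong a posEq) (sym (same-offset B (model-below (suc n) gv) r (c * b ^ n + r) o' ou νle l1 l2))
      where
        B : ℕ
        B = b * lam (suc n)
        r<bn : r < b ^ n
        r<bn = P-reflects-< (≤-<-trans lr zl)
        dv : b ^ n ∣ c * b ^ n
        dv = ∣n⇒∣m*n c ∣-refl
        posEq : c * lam (suc n) + (P r + o') ≡ P (c * b ^ n + r) + o'
        posEq = trans (cong (_+ (P r + o')) (sym (P-* c n cb))) (trans (sym (+-assoc (P (c * b ^ n)) (P r) o')) (cong (_+ o') (sym (P-+ n (c * b ^ n) r dv r<bn))))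
        ou : o' < U r
        ou = +-cancelˡ-< (P r) o' _ ur
        νle : νu r ≤ νu (c * b ^ n + r)
        νle with suc r <? b ^ n
        ... | yes sr = ≤-reflexive (sym (trans (cong ν (sym (+-suc (c * b ^ n) r))) (ν-+-multiple (c * b ^ n) (suc r) n dv (s≤s z≤n) (λ d → <⇒≱ sr (∣⇒≤⁺ d (s≤s z≤n))))))
        ... | no nsr = subst (_≤ νu (c * b ^ n + r)) (sym (trans (cong ν sreq) (ν-pow n)))
                         (ν-ge _ n (s≤s z≤n) (subst (b ^ n ∣_) (trans (cong (c * b ^ n +_) (sym sreq)) (+-suc (c * b ^ n) r))
                            (∣m∣n⇒∣m+n dv ∣-refl)))
          where
            sreq : suc r ≡ b ^ n
            sreq = ≤-antisym r<bn (≮⇒≥ nsr)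
        zB : P r + o' < B
        zB = <-≤-trans zl (subst (lam (suc n) ≤_) (sym refl) (m≤m+n (lam (suc n)) (m * lam (suc n))))
        l1 : P r + o' < B
        l1 = zB
        l2 : P (c * b ^ n + r) + o' < B
        l2 = subst (_< B) posEq (<-≤-trans (+-monoʳ-< (c * lam (suc n)) zl) (subst (_≤ B) (sym (+-comm (c * lam (suc n)) (lam (suc n)))) (*-monoˡ-≤ (lam (suc n)) cb)))

    module Block (N : ℕ) (gv : ValidGlues N) where
      λN : ℕ
      λN = lam N
      B : ℕ
      B = b * λN
      bl : List ℕ
      bl = pre λN

      baseEq : Glue.base C m bl ≡ pre B
      baseEq = sym (applyUpTo-periodic a λN b (λ c' z lt zl → a-lam-periodic N gv c' z lt zl))

      B≥1 : 1 ≤ B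
      B≥1 = *-mono-≤ {1} {b} (s≤s z≤n) (lam≥1 N)

      sprefEq : ∀ k → Glue.spref C m bl k ≡ applyUpTo (λ i → a (B + i)) k
      sprefEq zero = refl
      sprefEq (suc k) = trans (cong₂ (λ L v → L ++ (v ∷ [])) (sprefEq k) gk) (applyUpTo-∷ʳ (λ i → a (B + i)) k)
        where
          e : Glue.base C m bl ++ Glue.spref C m bl k ≡ pre (B + k)
          e = trans (cong₂ _++_ baseEq (sprefEq k)) (sym (applyUpTo-+ a B k))
          gk : Cm C m (Glue.base C m bl ++ Glue.spref C m bl k) ≡ a (B + k)
          gk = trans (cong (λ L → m ⊔ C L) e) (sym (a≡m⊔C (B + k) (≤-trans B≥1 (m≤m+n B k))))

      gEq : ∀ k → Glue.g C m bl k ≡ a (B + k)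
      gEq k = trans (cong (λ L → m ⊔ C L) (trans (cong₂ _++_ baseEq (sprefEq k)) (sym (applyUpTo-+ a B k)))) (sym (a≡m⊔C (B + k) (≤-trans B≥1 (m≤m+n B k))))

      lenBase : length (Glue.base C m bl) ≡ B
      lenBase = trans (cong length baseEq) (length-pre B)

      next-lt : ∀ j → j < B → Glue.next C m bl j ≡ just (a j)
      next-lt j lt rewrite baseEq | head-drop-< a B j lt = refl

      next-ge : ∀ k → Glue.next C m bl (B + k) ≡ (if Glue.inGlue C m bl k then just (a (B + k)) else nothing)
      next-ge k = begin
          Glue.next C m bl (B + k) ≡⟨ cong (_<∣> X) (trans (cong (λ L → head (drop (B + k) L)) baseEq) (head-drop-≥ a B (B + k) (m≤m+n B k))) ⟩
          (if Glue.inGlue C m bl ((B + k) ∸ length (Glue.base C m bl)) then just (Glue.g C m bl ((B + k) ∸ length (Glue.base C m bl))) else nothing)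
            ≡⟨ cong (λ z → if Glue.inGlue C m bl z then just (Glue.g C m bl z) else nothing) (trans (cong ((B + k) ∸_) lenBase) (m+n∸m≡n B k)) ⟩
          (if Glue.inGlue C m bl k then just (Glue.g C m bl k) else nothing) ≡⟨ cong (λ v → if Glue.inGlue C m bl k then just v else nothing) (gEq k) ⟩
          (if Glue.inGlue C m bl k then just (a (B + k)) else nothing) ∎
        where
          open ≡-Reasoning
          kk : ℕ
          kk = (B + k) ∸ length (Glue.base C m bl)
          X : Maybe ℕ
          X = if Glue.inGlue C m bl kk then just (Glue.g C m bl kk) else nothing

      inGlue-true : ∀ k → (∀ t → 1 ≤ t → t ≤ k → m < a (B + t)) → Glue.inGlue C m bl k ≡ true
      inGlue-true k h = trans (cong (allᵇ _) (map-upTo suc k)) (allᵇ-true-intro _ suc k (λ t lt → subst (λ v → (m <ᵇ v) ≡ true) (sym (gEq (suc t))) (T⇒≡true (<⇒<ᵇ (h (suc t) (s≤s z≤n) lt)))))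

      inGlue-false : ∀ k → Glue.inGlue C m bl k ≡ false → Σ ℕ λ t → 1 ≤ t × t ≤ k × a (B + t) ≡ m
      inGlue-false k eq with allᵇ-false⇒witness _ suc k (trans (sym (cong (allᵇ _) (map-upTo suc k))) eq)
      ... | (t , lt , e) = suc t , s≤s z≤n , lt , ≤-antisym (≮⇒≥ nlt) (m≤a (B + suc t))
        where
          nlt : ¬ (m < a (B + suc t))
          nlt l = subst (λ v → v ≡ false → ⊥) (sym (T⇒≡true (<⇒<ᵇ l))) (λ ()) (subst (λ v → (m <ᵇ v) ≡ false) (gEq (suc t)) e)

      aB>m : m < a B
      aB>m = <-≤-trans (n<1+n m) (≤-trans cb (C≤a B B≥1))
        where
          per : Periodic 0 B λN
          per y _ yl with quotRem y λN (lam≥1 N)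
          ... | (c , z , refl , zl) = trans (a-lam-periodic N gv c z cl zl) (sym (trans (cong a e2) (a-lam-periodic N gv (suc c) z sc<b zl)))
            where
              e2 : c * λN + z + λN ≡ suc c * λN + z
              e2 = trans (+-assoc (c * λN) z λN) (trans (cong (c * λN +_) (+-comm z λN)) (trans (sym (+-assoc (c * λN) λN z)) (cong (_+ z) (+-comm (c * λN) λN))))
              scl : suc c * λN < b * λN
              scl = ≤-<-trans (≤-trans (m≤m+n (suc c * λN) z) (≤-reflexive (sym e2))) yl
              sc<b : suc c < b
              sc<b with suc c <? b
              ... | yes l = l
              ... | no nl = ⊥-elim (<-irrefl refl (<-≤-trans scl (*-monoˡ-≤ λN (≮⇒≥ nl))))
              cl : c < b
              cl = <-trans (n<1+n c) sc<b
          cb : b ≤ C (pre B)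
          cb = periods≤C B 0 λN b (lam≥1 N) refl per

  lamL : (ℓ : ℕ → ℕ) → ℕ → ℕ
  lamL ℓ = Units.lam m m≥1 ℓ

  GVL : (ℓ : ℕ → ℕ) → ℕ → Set
  GVL ℓ = Layout.ValidGlues ℓ

  Blk' : ℕ → PString
  Blk' = Blk C m

  -- Blk n is B_{n+1}^(m); once undefined, it is the finite block a(0 .. lam ℓ k - 1) for valid ℓ.
  Gap : ℕ → ℕ → Set
  Gap n j = Σ (ℕ → ℕ) λ ℓ → Σ ℕ λ k → GVL ℓ k × lamL ℓ k ≤ j × (∀ j' → j' < lamL ℓ k → Blk' n j' ≡ just (a j')) × Blk' n (lamL ℓ k) ≡ nothing

  record Inv (n : ℕ) : Set where
    field
      agrees  : ∀ j x → Blk' n j ≡ just x → x ≡ a j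
      defined : ∀ j → j ≤ n → Σ ℕ λ x → Blk' n j ≡ just x
      gaps    : ∀ j → Blk' n j ≡ nothing → Gap n j

  gap-unique : ∀ n l₁ l₂ → Blk' n l₁ ≡ nothing → Blk' n l₂ ≡ nothing → (∀ j' → j' < l₁ → Blk' n j' ≡ just (a j')) → (∀ j' → j' < l₂ → Blk' n j' ≡ just (a j')) → l₁ ≡ l₂
  gap-unique n l₁ l₂ g₁ g₂ d₁ d₂ with <-cmp l₁ l₂
  ... | tri≈ _ e _ = e
  ... | tri< lt _ _ = ⊥-elim (nothing≢just (trans (sym g₁) (d₂ l₁ lt)))
  ... | tri> _ _ gt = ⊥-elim (nothing≢just (trans (sym g₂) (d₁ l₂ gt)))

  View : ℕ → ℕ → Set
  View n j = (Blk' (suc n) j ≡ Blk' n j × (∀ i → i < suc j → Σ ℕ λ x → Blk' n i ≡ just x))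
           ⊎ (Σ (ℕ → ℕ) λ ℓ → Σ ℕ λ k → GVL ℓ k × lamL ℓ k ≤ j × (∀ j' → j' < lamL ℓ k → Blk' n j' ≡ just (a j')) × Blk' n (lamL ℓ k) ≡ nothing
               × Blk' (suc n) j ≡ Glue.next C m (pre (lamL ℓ k)) j)

  view : ∀ n j → Inv n → View n j
  view n j inv with firstGap (map (Blk' n) (upTo (suc j))) in eq
  ... | nothing = inj₁ (refl , firstGap-nothing⇒defined (Blk' n) (suc j) (trans (cong firstGap (sym (map-upTo (Blk' n) (suc j)))) eq))
  ... | just L with firstGap-just⇒gap (Blk' n) (suc j) L (trans (cong firstGap (sym (map-upTo (Blk' n) (suc j)))) eq)
  ... | (i , lt , e) with Inv.gaps inv i e
  ... | (ℓ , k , gv , le , defs , gap) = inj₂ (ℓ , k , gv , ≤-trans le (≤-pred lt) , defs , gap , cong (λ L' → Glue.next C m L' j) L≡)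
    where
      fs : firstGap (applyUpTo (Blk' n) (suc j)) ≡ just (pre (lamL ℓ k))
      fs = firstGap-just (Blk' n) a (suc j) (lamL ℓ k) (≤-<-trans le lt) defs gap
      L≡ : L ≡ pre (lamL ℓ k)
      L≡ = just-injective (trans (sym eq) (trans (cong firstGap (map-upTo (Blk' n) (suc j))) fs))

  ValidGlueAt : ℕ → ℕ → Set
  ValidGlueAt l L = (1 ≤ l) × (∀ k' → k' < l → m < a (suc m * L + k')) × (a (suc m * L + l) ≡ m)

  next-value : ∀ ℓ k → GVL ℓ k → ∀ j x → Glue.next C m (pre (lamL ℓ k)) j ≡ just x → x ≡ a j
  next-value ℓ k gv j x eq with j <? B
    where open GlueBlocks.Block ℓ k gv
  ... | yes lt = sym (just-injective (trans (sym (GlueBlocks.Block.next-lt ℓ k gv j lt)) eq))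
  ... | no nlt with ≤⇒≡+ (≮⇒≥ nlt)
  ... | (t , refl) with Glue.inGlue C m (pre (lamL ℓ k)) t in ig
  ... | true = sym (just-injective (trans (sym (trans (GlueBlocks.Block.next-ge ℓ k gv t) (cong (λ z → if z then just (a (GlueBlocks.Block.B ℓ k gv + t)) else nothing) ig))) eq))
  ... | false = ⊥-elim (nothing≢just (trans (sym (trans (GlueBlocks.Block.next-ge ℓ k gv t) (cong (λ z → if z then just (a (GlueBlocks.Block.B ℓ k gv + t)) else nothing) ig))) eq))

  module Extend (n : ℕ) (inv : Inv n) (ℓ : ℕ → ℕ) (k : ℕ) (gv : GVL ℓ k)
            (defs : ∀ j' → j' < lamL ℓ k → Blk' n j' ≡ just (a j')) (gap : Blk' n (lamL ℓ k) ≡ nothing)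
            (j : ℕ) (t₀ : ℕ) (jeq : j ≡ GlueBlocks.Block.B ℓ k gv + t₀) (ℓn' : ℕ)
            (aq : a (GlueBlocks.Block.B ℓ k gv + suc ℓn') ≡ m)
            (mn : ∀ t' → t' < suc ℓn' → ¬ ((1 ≤ t') × (a (GlueBlocks.Block.B ℓ k gv + t') ≡ m)))
            (ℓn≤t₀ : suc ℓn' ≤ t₀) where
    open GlueBlocks.Block ℓ k gv
    λk : ℕ
    λk = lamL ℓ k
    ℓn : ℕ
    ℓn = suc ℓn'
    big : ∀ t' → t' < ℓn → m < a (B + t')
    big zero _ = subst (λ z → m < a z) (sym (+-identityʳ B)) aB>m
    big (suc t') lt = ≤∧≢⇒< (m≤a (B + suc t')) (λ e → mn (suc t') lt (s≤s z≤n , sym e))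
    ℓ' : ℕ → ℕ
    ℓ' u = if u ≡ᵇ k then ℓn else ℓ u
    ℓ'k : ℓ' k ≡ ℓn
    ℓ'k rewrite T⇒≡true (≡⇒≡ᵇ k k refl) = refl
    ℓ'u : ∀ u → u < k → ℓ' u ≡ ℓ u
    ℓ'u u lt with u ≡ᵇ k in e
    ... | false = refl
    ... | true = ⊥-elim (<-irrefl (≡ᵇ⇒≡ u k (subst T (sym e) tt)) lt)
    lamAg : ∀ u → u ≤ k → lamL ℓ' u ≡ lamL ℓ u
    lamAg zero _ = refl
    lamAg (suc u) le = trans (Units.lam-suc m m≥1 ℓ' u) (trans (cong₂ (λ L l → suc m * L + l) (lamAg u (≤-trans (n≤1+n u) le)) (ℓ'u u le)) (sym (Units.lam-suc m m≥1 ℓ u)))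
    GV' : GVL ℓ' (suc k)
    GV' u lt with u <? k
    ... | yes l = subst₂ ValidGlueAt (sym (ℓ'u u l)) (sym (lamAg u (<⇒≤ l))) (gv u l)
    ... | no nl = subst (λ z → ValidGlueAt (ℓ' z) (lamL ℓ' z)) (sym ueq) (subst₂ ValidGlueAt (sym ℓ'k) (sym (lamAg k ≤-refl)) (s≤s z≤n , big , aq))
      where
        ueq : u ≡ k
        ueq = ≤-antisym (≤-pred lt) (≮⇒≥ nl)
    λ'eq : lamL ℓ' (suc k) ≡ B + ℓn
    λ'eq = trans (Units.lam-suc m m≥1 ℓ' k) (cong₂ (λ L l → suc m * L + l) (lamAg k ≤-refl) ℓ'k)
    λ'≤j : lamL ℓ' (suc k) ≤ j
    λ'≤j = subst (_≤ j) (sym λ'eq) (subst (B + ℓn ≤_) (sym jeq) (+-monoʳ-≤ B ℓn≤t₀))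
    nextAt : ∀ j' → j' < B + ℓn → Glue.next C m bl j' ≡ just (a j')
    nextAt j' lt with j' <? B
    ... | yes l = next-lt j' l
    ... | no nl with ≤⇒≡+ (≮⇒≥ nl)
    ... | (t' , refl) = trans (next-ge t') (cong (λ z → if z then just (a (B + t')) else nothing) (inGlue-true t' (λ t'' _ le → big t'' (≤-<-trans le (+-cancelˡ-< B t' ℓn lt)))))
    redirect : ∀ j' → View n j' → (Blk' (suc n) j' ≡ Blk' n j' × (∀ i → i < suc j' → Σ ℕ λ x → Blk' n i ≡ just x)) ⊎ (Blk' (suc n) j' ≡ Glue.next C m bl j')
    redirect j' (inj₁ x) = inj₁ x
    redirect j' (inj₂ (ℓ₂ , k₂ , gv₂ , le₂ , defs₂ , gap₂ , e₂)) = inj₂ (trans e₂ (cong (λ z → Glue.next C m (pre z) j') (gap-unique n _ _ gap₂ gap defs₂ defs)))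
    defs' : ∀ j' → j' < lamL ℓ' (suc k) → Blk' (suc n) j' ≡ just (a j')
    defs' j' lt with redirect j' (view n j' inv)
    ... | inj₁ (e' , all') = trans e' (trans (proj₂ (all' j' (n<1+n j'))) (cong just (Inv.agrees inv j' _ (proj₂ (all' j' (n<1+n j'))))))
    ... | inj₂ e' = trans e' (nextAt j' (subst (j' <_) λ'eq lt))
    igf : Glue.inGlue C m bl ℓn ≡ false
    igf = trans (cong (allᵇ _) (map-upTo suc ℓn)) (allᵇ-false-intro _ suc ℓn ℓn' ≤-refl (trans (cong (m <ᵇ_) (trans (gEq ℓn) aq)) (n<ᵇn≡false m)))
    gap' : Blk' (suc n) (lamL ℓ' (suc k)) ≡ nothing
    gap' with redirect (lamL ℓ' (suc k)) (view n (lamL ℓ' (suc k)) inv)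
    ... | inj₁ (_ , all') = ⊥-elim (just≢nothing (trans (sym (proj₂ (all' λk lt'))) gap))
      where
        lt' : λk < suc (lamL ℓ' (suc k))
        lt' = s≤s (subst (λk ≤_) (sym λ'eq) (≤-trans (m≤m+n λk (m * λk)) (m≤m+n B ℓn)))
    ... | inj₂ e' = trans e' (trans (cong (Glue.next C m bl) λ'eq) (trans (next-ge ℓn) (cong (λ z → if z then just (a (B + ℓn)) else nothing) igf)))
    new-gap : Gap (suc n) j
    new-gap = ℓ' , suc k , GV' , λ'≤j , defs' , gap'

  gap-next : ∀ n → Inv n → ∀ ℓ k → (gv : GVL ℓ k) → (∀ j' → j' < lamL ℓ k → Blk' n j' ≡ just (a j')) → Blk' n (lamL ℓ k) ≡ nothing
           → ∀ j → Glue.next C m (pre (lamL ℓ k)) j ≡ nothing → Gap (suc n) j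
  gap-next n inv ℓ k gv defs gap j nxt = past-blocks (proj₁ (≤⇒≡+ j≥B)) (proj₂ (≤⇒≡+ j≥B))
    where
      open GlueBlocks.Block ℓ k gv
      j≥B : B ≤ j
      j≥B with j <? B
      ... | yes lt = ⊥-elim (just≢nothing (trans (sym (next-lt j lt)) nxt))
      ... | no nlt = ≮⇒≥ nlt
      -- The least t with Q t is the length of the glue appended to B_{k+1}^b.
      Q : ℕ → Set
      Q t = (1 ≤ t) × (a (B + t) ≡ m)
      dq : ∀ t → Dec (Q t)
      dq t = (1 ≤? t) ×-dec (a (B + t) ≟ m)
      from-glue-end : ∀ t₀ → j ≡ B + t₀ → (Σ ℕ λ t → Q t × (∀ t' → t' < t → ¬ Q t')) → (Σ ℕ λ t → t ≤ t₀ × Q t) → Gap (suc n) j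
      from-glue-end t₀ jeq (zero , (() , _) , _) _
      from-glue-end t₀ jeq (suc ℓn' , (_ , aq) , mn) (t , tle , qt) = Extend.new-gap n inv ℓ k gv defs gap j t₀ jeq ℓn' aq mn le
        where
          le : suc ℓn' ≤ t₀
          le with suc ℓn' ≤? t
          ... | yes l = ≤-trans l tle
          ... | no nl = ⊥-elim (mn t (≰⇒> nl) qt)
      past-blocks : ∀ t₀ → j ≡ B + t₀ → Gap (suc n) j
      past-blocks t₀ jeq = via-first-m (inGlue-false t₀ ig)
        where
          ig : Glue.inGlue C m bl t₀ ≡ false
          ig with Glue.inGlue C m bl t₀ in e
          ... | false = refl
          ... | true = ⊥-elim (just≢nothing (trans (sym (trans (next-ge t₀) (cong (λ z → if z then just (a (B + t₀)) else nothing) e))) (trans (cong (Glue.next C m bl) (sym jeq)) nxt)))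
          via-first-m : (Σ ℕ λ t → 1 ≤ t × t ≤ t₀ × a (B + t) ≡ m) → Gap (suc n) j
          via-first-m (t , t1 , tle , at) = from-glue-end t₀ jeq (LeastWitness.least Q dq t₀ (t , tle , (t1 , at))) (t , tle , (t1 , at))

  Inv-suc : ∀ n → Inv n → Inv (suc n)
  Inv-suc n inv = record { agrees = agrees ; defined = defined ; gaps = gaps }
    where
      agrees : ∀ j x → Blk' (suc n) j ≡ just x → x ≡ a j
      agrees j x eq with view n j inv
      ... | inj₁ (e , _) = Inv.agrees inv j x (trans (sym e) eq)
      ... | inj₂ (ℓ , k , gv , le , defs , gap , e) = next-value ℓ k gv j x (trans (sym e) eq)
      defined : ∀ j → j ≤ suc n → Σ ℕ λ x → Blk' (suc n) j ≡ just x
      defined j le with view n j inv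
      ... | inj₁ (e , all) = proj₁ (all j (n<1+n j)) , trans e (proj₂ (all j (n<1+n j)))
      ... | inj₂ (ℓ , k , gv , lej , defs , gap , e) = a j , trans e (GlueBlocks.Block.next-lt ℓ k gv j jB)
        where
          λk : ℕ
          λk = lamL ℓ k
          nλ : n < λk
          nλ with n <? λk
          ... | yes l = l
          ... | no nl = ⊥-elim (nothing≢just (trans (sym gap) (proj₂ (Inv.defined inv λk (≮⇒≥ nl)))))
          jB : j < suc m * λk
          jB = ≤-<-trans (≤-trans le nλ) (subst (_< suc m * λk) (+-identityʳ λk) (+-monoʳ-< λk (*-mono-≤ m≥1 (GlueBlocks.lam≥1 ℓ k))))
      gaps : ∀ j → Blk' (suc n) j ≡ nothing → Gap (suc n) j
      gaps j eq with view n j inv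
      ... | inj₁ (e , all) = ⊥-elim (nothing≢just (trans (sym eq) (trans e (proj₂ (all j (n<1+n j))))))
      ... | inj₂ (ℓ , k , gv , le , defs , gap , e) = gap-next n inv ℓ k gv defs gap j (trans (sym e) eq)

  Inv-zero : Inv 0
  Inv-zero = record { agrees = agrees ; defined = defined ; gaps = gaps }
    where
      agrees : ∀ j x → Blk' 0 j ≡ just x → x ≡ a j
      agrees zero x eq = sym (just-injective eq)
      agrees (suc j) x ()
      defined : ∀ j → j ≤ 0 → Σ ℕ λ x → Blk' 0 j ≡ just x
      defined zero _ = m , refl
      gaps : ∀ j → Blk' 0 j ≡ nothing → Gap 0 j
      gaps zero ()
      gaps (suc j) _ = (λ _ → 0) , 0 , (λ u ()) , s≤s z≤n , defs , refl
        where
          defs : ∀ j' → j' < 1 → Blk' 0 j' ≡ just (a j')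
          defs zero _ = refl
          defs (suc j') (s≤s ())

  Inv-all : ∀ n → Inv n
  Inv-all zero = Inv-zero
  Inv-all (suc n) = Inv-suc n (Inv-all n)

theorem2 : (C : List ℕ → ℕ) → (∀ U → U ≢ [] → IsCurling U (C U)) →
    (m : ℕ) → 1 ≤ m →
    (∀ n j x → Blk C m n j ≡ just x → x ≡ Aseq C m j)
    × (∀ j → ∃[ n ] (Blk C m n j ≡ just (Aseq C m j)))
theorem2 C hC m m≥1 = (λ n → Inv.agrees (Inv-all n)) , reached
  where
    open BlockConstruction C hC m m≥1
    reached : ∀ j → ∃[ n ] (Blk C m n j ≡ just (Aseq C m j))
    reached j with Inv.defined (Inv-all j) j ≤-refl
    ... | (x , e) = j , subst (λ z → Blk C m j j ≡ just z) (Inv.agrees (Inv-all j) j x e) e
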